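{- Let $0\le r\le n/2$, let $B=\bigcup_{i=0}^r S(n,i)$, let $A$ be the adjacency matrix of the subgraph of the Hamming cube induced by $B$, and let $y\in B$ with $|y|=t$. Then $\dim W_y = r-t+1$. Moreover, for each $t\le i\le r$ there is a unique function $f_{y,i}\in V_{y,i}$ with $f_{y,i}(x)=1$ for all $x\in S(n,i)$ with $y\subseteq x$; viewing $f_{y,i}$ as a function on $B$ vanishing outside $S(n,i)$, the functions $f_{y,t},\dots,f_{y,r}$ form a basis of $W_y$, and $A$ acts on them by $$A f_{y,i} = \beta_i f_{y,i-1} + \gamma_i f_{y,i+1}\qquad (t\le i\le r),$$ with the conventions $f_{y,t-1}=f_{y,r+1}=0$, where $\beta_i = n-i+1$ and $\gamma_i = \frac{(i-t+1)(n-t-i)}{n-i}$. Equivalently, the matrix of $A|_{W_y}$ in this basis is tridiagonal with zero diagonal, superdiagonal entries $\beta_{t+1},\dots,\beta_r$ and subdiagonal entries $\gamma_t,\dots,\gamma_{r-1}$.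
   Context: Points of $\{0,1\}^n$ are identified with subsets of $\{1,\dots,n\}$; $|x|$ is Hamming weight, $|x-y|$ Hamming distance, $S(n,i)=\{x:|x|=i\}$; the Hamming cube graph joins points at distance $1$. $S^{(B)}_z$ is the space of real functions $f$ on $B$ with $f(x)$ depending only on $(|x|,|x-z|)$, and $W_y=S^{(B)}_y\cap(\mathrm{span}\{S^{(B)}_z: z\in B, |z|<|y|\})^\perp$ (orthogonal complement in the standard inner product on functions on $B$; empty span is $\{0\}$). $V_{y,i}$ is the space of functions in the $t$-th eigenspace $V_t$ of $S(n,i)$ whose value at $x$ depends only on $|x-y|$. Eigenspaces of $S(n,i)$: for $|z|\le i$ let $g_z(x)=1$ if $z\subseteq x$ and $0$ otherwise on $S(n,i)$; let $U_j=\mathrm{span}\{g_z:|z|\le j\}$; $V_0=U_0$ (constants) and $V_j=U_j\cap U_{j-1}^\perp$ for $1\le j\le i$.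
   Formalization: The coefficient field is ℚ rather than ℝ: functions on B and on S(n,i) take rational values, and linear combinations, bases and the dimension of $W_y$ are taken over ℚ. -}

module Defs where

open import Data.Bool using (Bool; true; false; if_then_else_; _xor_)
open import Data.Nat as ℕ using (ℕ; zero; suc; _≤_; _<_; _∸_; _≤ᵇ_; _≡ᵇ_)
open import Data.Integer using (+_)
open import Data.Rational using (ℚ; 0ℚ; 1ℚ; _+_; _*_; _/_)
open import Data.List as List using (List; []; _∷_; foldr; map; length; upTo)
open import Data.Vec as Vec using (Vec; []; _∷_; zipWith; lookup)
open import Data.Fin using (Fin)
open import Data.Fin.Subset using (Subset; ∣_∣; _⊆_)
open import Data.Fin.Subset.Properties using (_⊆?_)
open import Data.Product using (Σ; _×_; ∃)
open import Relation.Binary.PropositionalEquality using (_≡_)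
open import Relation.Nullary using (does)

-- Points of {0,1}^n are subsets of {1..n} (Subset n = Vec Bool n).
-- Weight |x| is ∣ x ∣ (library cardinality); Hamming distance:
dist : ∀ {n} → Subset n → Subset n → ℕ
dist x y = ∣ zipWith _xor_ x y ∣

allPts : (n : ℕ) → List (Subset n)
allPts zero = [] ∷ []
allPts (suc n) = map (false ∷_) (allPts n) List.++ map (true ∷_) (allPts n)

sumℚ : List ℚ → ℚ
sumℚ = foldr _+_ 0ℚ

ℕ→ℚ : ℕ → ℚ
ℕ→ℚ k = + k / 1

-- a / d, with the (never used) convention a / 0 = 0
frac : ℕ → ℕ → ℚ
frac a zero = 0ℚ
frac a (suc d) = + a / suc d

-- Real(-valued) functions on points; we use rational scalars.
Fn : ℕ → Set
Fn n = Subset n → ℚ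

module _ {n : ℕ} (r : ℕ) where
  InB : Subset n → Set
  InB x = ∣ x ∣ ≤ r

  _≈B_ : Fn n → Fn n → Set
  f ≈B g = ∀ x → InB x → f x ≡ g x

  ΣB : Fn n → ℚ
  ΣB f = sumℚ (map (λ x → if ∣ x ∣ ≤ᵇ r then f x else 0ℚ) (allPts n))

  ⟨_,_⟩B : Fn n → Fn n → ℚ
  ⟨ f , g ⟩B = ΣB (λ x → f x * g x)

  adjB : Fn n → Fn n
  adjB f x = ΣB (λ x' → if dist x x' ≡ᵇ 1 then f x' else 0ℚ)

  InS : Subset n → Fn n → Set
  InS z f = ∀ x x' → InB x → InB x' → ∣ x ∣ ≡ ∣ x' ∣ → dist x z ≡ dist x' z → f x ≡ f x'

  -- g ∈ span { S^(B)_z : z ∈ B, |z| < |y| }  (a finite sum of elements of these subspaces)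
  InSpanLower : Subset n → Fn n → Set
  InSpanLower y g = Σ (List (Subset n × Fn n)) λ l →
    All' l × (g ≈B (λ x → sumℚ (map (λ p → Data.Product.proj₂ p x) l)))
    where
      All' : List (Subset n × Fn n) → Set
      All' [] = Data.Unit.⊤
        where import Data.Unit
      All' ((z Data.Product., h) ∷ l) = (InB z × ∣ z ∣ < ∣ y ∣ × InS z h) × All' l

  InW : Subset n → Fn n → Set
  InW y f = InS y f × (∀ g → InSpanLower y g → ⟨ f , g ⟩B ≡ 0ℚ)

  lincomb : (fs : List (Fn n)) → Vec ℚ (length fs) → Fn n
  lincomb [] [] x = 0ℚ
  lincomb (f ∷ fs) (c ∷ cs) x = c * f x + lincomb fs cs x

  IsBasis : (Fn n → Set) → List (Fn n) → Set
  IsBasis P fs =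
    (∀ k → P (List.lookup fs k)) ×
    (∀ (cs : Vec ℚ (length fs)) → lincomb fs cs ≈B (λ _ → 0ℚ) → ∀ k → lookup cs k ≡ 0ℚ) ×
    (∀ h → P h → ∃ λ (cs : Vec ℚ (length fs)) → h ≈B lincomb fs cs)

  HasDim : (Fn n → Set) → ℕ → Set
  HasDim P d = Σ (List (Fn n)) λ fs → length fs ≡ d × IsBasis P fs

-- Functions on the slice S(n,i) (values off S(n,i) are irrelevant)
module _ {n : ℕ} (i : ℕ) where
  InSl : Subset n → Set
  InSl x = ∣ x ∣ ≡ i

  ΣSl : Fn n → ℚ
  ΣSl f = sumℚ (map (λ x → if ∣ x ∣ ≡ᵇ i then f x else 0ℚ) (allPts n))

  ⟨_,_⟩Sl : Fn n → Fn n → ℚ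
  ⟨ f , g ⟩Sl = ΣSl (λ x → f x * g x)

  gz : Subset n → Fn n
  gz z x = if does (z ⊆? x) then 1ℚ else 0ℚ

  InU : ℕ → Fn n → Set
  InU j h = ∃ λ (c : Fn n) → ∀ x → InSl x →
    h x ≡ sumℚ (map (λ z → if ∣ z ∣ ≤ᵇ j then c z * gz z x else 0ℚ) (allPts n))

  InV : ℕ → Fn n → Set
  InV zero h = InU zero h
  InV (suc j) h = InU (suc j) h × (∀ h' → InU j h' → ⟨ h , h' ⟩Sl ≡ 0ℚ)

  InVy : Subset n → Fn n → Set
  InVy y h = InV ∣ y ∣ h × (∀ x x' → InSl x → InSl x' → dist x y ≡ dist x' y → h x ≡ h x')

  OneAbove : Subset n → Fn n → Set
  OneAbove y h = ∀ x → InSl x → y ⊆ x → h x ≡ 1ℚ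

_•_ : ∀ {n} → ℚ → Fn n → Fn n
(c • f) x = c * f x

_⊕_ : ∀ {n} → Fn n → Fn n → Fn n
(f ⊕ g) x = f x + g x

zeroFn : ∀ {n} → Fn n
zeroFn _ = 0ℚ

β : ℕ → ℕ → ℚ
β n i = ℕ→ℚ (suc (n ∸ i))

γ : ℕ → ℕ → ℕ → ℚ
γ n t i = frac (suc (i ∸ t) ℕ.* (n ∸ t ∸ i)) (n ∸ i)

prevF : ∀ {n} → (ℕ → Fn n) → ℕ → ℕ → Fn n
prevF f t i = if t ℕ.<ᵇ i then f (i ∸ 1) else zeroFn

nextF : ∀ {n} → (ℕ → Fn n) → ℕ → ℕ → Fn n
nextF f r i = if i ℕ.<ᵇ r then f (suc i) else zeroFn

famList : ∀ {n} → (ℕ → Fn n) → ℕ → ℕ → List (Fn n)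
famList f t r = map (λ k → f (t ℕ.+ k)) (upTo (suc (r ∸ t)))

{-# OPTIONS --safe #-}
-- Write t = ∣ y ∣.  On a slice S(n,i) a function of the distance to y is a function of p = ∣ x ∩ y ∣,
-- and f_{y,i}(x) = ψ_{i-t,n-i}(t - p) with ψ_{s,m}(a) = ∏_{k=1}^{a} -(s+k)/(m-k+1).
--
-- Sorting the neighbours of x by the kind of coordinate flipped (in y ∖ x, x ∩ y, x ∖ y, or outside
-- x ∪ y) turns (A f_{y,i})(x) into four ψ-terms, and three recurrences for ψ collapse them to
-- β_i f_{y,i-1} + γ_i f_{y,i+1}.
--
-- For F supported on level j+1, pairing A F with g_z on level j gives (j+1-∣ z ∣) ⟨F, g_z⟩, since every
-- x ⊇ z of weight j+1 has that many lower neighbours ⊇ z.  As A f_{y,j+1} = β f_{y,j} on level j, this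
-- gives ⟨f_{y,i}, g_z⟩ = 0 for ∣ z ∣ < t by induction on i.  Möbius inversion on the subsets of y
-- writes f_{y,i} through the g_z with z ⊆ y, so f_{y,i} ∈ U_t and hence f_{y,i} ∈ V_t; Möbius inversion
-- on the subsets of z writes any h ∈ S_z, restricted to a slice, through the g_v with v ⊆ z, so
-- f_{y,i} ⊥ S_z whenever ∣ z ∣ < t, i.e. f_{y,i} ∈ W_y.
--
-- Finally, a function on a slice that depends only on ∣ x ∩ y ∣, vanishes on the x ⊇ y and is orthogonal
-- to every g_z with z ⊊ y is zero: by descending induction on ∣ x ∩ y ∣, testing against g_{x ∩ y}.
-- This gives the uniqueness of f_{y,i}, and shows that every h ∈ W_y equals ∑_i h(x_i) f_{y,i} for any
-- choice of x_i ⊇ y of weight i, so the f_{y,i} form a basis.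
module Submission where

module HammingBall where
  open import Defs
  open import Data.Bool using (Bool; true; false; if_then_else_; not; T; _∧_)
  open import Data.Bool.Properties using (∧-zeroʳ; ∧-identityʳ; T-≡; ¬-not)
  open import Function.Bundles using (Equivalence)
  open import Data.Unit using (tt)
  open import Data.Empty using (⊥-elim)
  open import Data.Nat as ℕ using (ℕ; zero; suc; _≤_; _<_; z≤n; s≤s; _∸_; _≡ᵇ_; _<ᵇ_; _≤ᵇ_)
  import Data.Nat.Properties as ℕP
  open import Data.Integer as ℤ using (+_)
  import Data.Integer.Properties as ℤP
  open import Data.Rational as ℚ using (ℚ; 0ℚ; 1ℚ; _+_; _*_; -_; _-_; 1/_; toℚᵘ; ≢-nonZero)
  open import Data.Rational.Properties
  import Data.Rational.Unnormalised as ℚᵘ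
  import Data.Rational.Unnormalised.Properties as ℚᵘP
  open import Data.Rational.Solver
  open +-*-Solver using (solve; _:+_; _:*_; :-_; _:-_; _:=_; con)
  open import Data.List as List using (List; []; _∷_; length; map; _++_; applyUpTo; upTo)
  open import Data.List.Properties using (length-map; length-upTo)
  open import Data.Vec using (Vec; []; _∷_; lookup; tabulate)
  import Data.Vec.Properties as VecP
  open import Data.Fin as Fin using (Fin; toℕ; fromℕ<)
  import Data.Fin.Properties as FinP
  open import Data.Fin.Subset using (Subset; ∣_∣; _⊆_; _∩_)
  open import Data.Fin.Subset.Properties using (_⊆?_; ∣p∣≤n)
  open import Data.Product using (_×_; _,_; ∃; proj₁; proj₂)
  open import Function using (_∘_)
  open import Relation.Binary.PropositionalEquality
  open import Relation.Nullary using (¬_; Dec; does; yes; no)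
  open import Algebra.Properties.CommutativeSemigroup ℕP.+-commutativeSemigroup using (interchange)

  -- Arithmetic

  toℚᵘ-/ : ∀ (i : ℤ.ℤ) d → toℚᵘ (i ℚ./ suc d) ℚᵘ.≃ ℚᵘ.mkℚᵘ i d
  toℚᵘ-/ i d = toℚᵘ-fromℚᵘ (ℚᵘ.mkℚᵘ i d)

  ℕ→ℚ-suc : ∀ a → ℕ→ℚ (suc a) ≡ 1ℚ + ℕ→ℚ a
  ℕ→ℚ-suc a = toℚᵘ-injective (ℚᵘP.≃-trans (toℚᵘ-/ (+ suc a) 0)
     (ℚᵘP.≃-trans (ℚᵘ.*≡* e) (ℚᵘP.≃-sym (ℚᵘP.≃-trans (toℚᵘ-homo-+ 1ℚ (ℕ→ℚ a))
       (ℚᵘP.+-cong (toℚᵘ-/ (+ 1) 0) (toℚᵘ-/ (+ a) 0))))))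
    where
    e : + suc a ℤ.* + 1 ≡ (+ 1 ℤ.* + 1 ℤ.+ + a ℤ.* + 1) ℤ.* + 1
    e = begin
        + suc a ℤ.* + 1 ≡⟨ ℤP.*-identityʳ _ ⟩
        + suc a ≡⟨ cong (λ k → + 1 ℤ.+ k) (sym (ℤP.*-identityʳ (+ a))) ⟩
        + 1 ℤ.* + 1 ℤ.+ + a ℤ.* + 1 ≡⟨ sym (ℤP.*-identityʳ _) ⟩
        _ ∎
      where open ≡-Reasoning

  ℕ→ℚ-+ : ∀ a b → ℕ→ℚ (a ℕ.+ b) ≡ ℕ→ℚ a + ℕ→ℚ b
  ℕ→ℚ-+ zero b = sym (+-identityˡ (ℕ→ℚ b))
  ℕ→ℚ-+ (suc a) b = begin
    ℕ→ℚ (suc (a ℕ.+ b)) ≡⟨ ℕ→ℚ-suc (a ℕ.+ b) ⟩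
    1ℚ + ℕ→ℚ (a ℕ.+ b) ≡⟨ cong (λ k → 1ℚ + k) (ℕ→ℚ-+ a b) ⟩
    1ℚ + (ℕ→ℚ a + ℕ→ℚ b) ≡⟨ sym (+-assoc 1ℚ (ℕ→ℚ a) (ℕ→ℚ b)) ⟩
    (1ℚ + ℕ→ℚ a) + ℕ→ℚ b ≡⟨ cong (_+ ℕ→ℚ b) (sym (ℕ→ℚ-suc a)) ⟩
    ℕ→ℚ (suc a) + ℕ→ℚ b ∎
    where open ≡-Reasoning

  ℕ→ℚ-* : ∀ a b → ℕ→ℚ (a ℕ.* b) ≡ ℕ→ℚ a * ℕ→ℚ b
  ℕ→ℚ-* zero b = sym (*-zeroˡ (ℕ→ℚ b))
  ℕ→ℚ-* (suc a) b = begin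
    ℕ→ℚ (b ℕ.+ a ℕ.* b) ≡⟨ ℕ→ℚ-+ b (a ℕ.* b) ⟩
    ℕ→ℚ b + ℕ→ℚ (a ℕ.* b) ≡⟨ cong (λ k → ℕ→ℚ b + k) (ℕ→ℚ-* a b) ⟩
    ℕ→ℚ b + ℕ→ℚ a * ℕ→ℚ b ≡⟨ cong (_+ ℕ→ℚ a * ℕ→ℚ b) (sym (*-identityˡ (ℕ→ℚ b))) ⟩
    1ℚ * ℕ→ℚ b + ℕ→ℚ a * ℕ→ℚ b ≡⟨ sym (*-distribʳ-+ (ℕ→ℚ b) 1ℚ (ℕ→ℚ a)) ⟩
    (1ℚ + ℕ→ℚ a) * ℕ→ℚ b ≡⟨ cong (_* ℕ→ℚ b) (sym (ℕ→ℚ-suc a)) ⟩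
    ℕ→ℚ (suc a) * ℕ→ℚ b ∎
    where open ≡-Reasoning

  ℕ→ℚ-∸ : ∀ a b → b ℕ.≤ a → ℕ→ℚ (a ℕ.∸ b) ≡ ℕ→ℚ a - ℕ→ℚ b
  ℕ→ℚ-∸ a b b≤a = begin
    ℕ→ℚ (a ℕ.∸ b) ≡⟨ sym (+-identityʳ (ℕ→ℚ (a ℕ.∸ b))) ⟩
    ℕ→ℚ (a ℕ.∸ b) + 0ℚ ≡⟨ cong (λ k → ℕ→ℚ (a ℕ.∸ b) + k) (sym (+-inverseʳ (ℕ→ℚ b))) ⟩
    ℕ→ℚ (a ℕ.∸ b) + (ℕ→ℚ b - ℕ→ℚ b) ≡⟨ sym (+-assoc (ℕ→ℚ (a ℕ.∸ b)) (ℕ→ℚ b) (- ℕ→ℚ b)) ⟩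
    (ℕ→ℚ (a ℕ.∸ b) + ℕ→ℚ b) - ℕ→ℚ b ≡⟨ cong (_- ℕ→ℚ b) (sym (ℕ→ℚ-+ (a ℕ.∸ b) b)) ⟩
    ℕ→ℚ (a ℕ.∸ b ℕ.+ b) - ℕ→ℚ b ≡⟨ cong (λ k → ℕ→ℚ k - ℕ→ℚ b) (ℕP.m∸n+n≡m b≤a) ⟩
    ℕ→ℚ a - ℕ→ℚ b ∎
    where open ≡-Reasoning

  ℕ→ℚ-injective : ∀ a b → ℕ→ℚ a ≡ ℕ→ℚ b → a ≡ b
  ℕ→ℚ-injective a b e with toℚᵘ-cong e
  ... | x = ℤP.+-injective (trans (sym (ℤP.*-identityʳ (+ a))) (trans (ℚᵘP.drop-*≡* helper) (ℤP.*-identityʳ (+ b))))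
    where
    helper : ℚᵘ.mkℚᵘ (+ a) 0 ℚᵘ.≃ ℚᵘ.mkℚᵘ (+ b) 0
    helper = ℚᵘP.≃-trans (ℚᵘP.≃-sym (toℚᵘ-/ (+ a) 0)) (ℚᵘP.≃-trans x (toℚᵘ-/ (+ b) 0))

  ℕ→ℚ-suc≢0 : ∀ k → ℕ→ℚ (suc k) ≢ 0ℚ
  ℕ→ℚ-suc≢0 k e with ℕ→ℚ-injective (suc k) 0 e
  ... | ()

  ℕ→ℚ-pos≢0 : ∀ k → 0 < k → ℕ→ℚ k ≢ 0ℚ
  ℕ→ℚ-pos≢0 (suc k) _ = ℕ→ℚ-suc≢0 k

  frac-*-denominator : ∀ a d → frac a (suc d) * ℕ→ℚ (suc d) ≡ ℕ→ℚ a
  frac-*-denominator a d = toℚᵘ-injective (ℚᵘP.≃-trans (toℚᵘ-homo-* (frac a (suc d)) (ℕ→ℚ (suc d)))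
    (ℚᵘP.≃-trans (ℚᵘP.*-cong (toℚᵘ-/ (+ a) d) (toℚᵘ-/ (+ suc d) 0)) (ℚᵘP.≃-trans (ℚᵘ.*≡* e) (ℚᵘP.≃-sym (toℚᵘ-/ (+ a) 0)))))
    where
    e : (+ a ℤ.* + suc d) ℤ.* + 1 ≡ + a ℤ.* (+ suc d ℤ.* + 1)
    e = ℤP.*-assoc (+ a) (+ suc d) (+ 1)

  ℕ→ℚ-*-frac1 : ∀ k → 0 < k → ℕ→ℚ k * frac 1 k ≡ 1ℚ
  ℕ→ℚ-*-frac1 (suc d) _ = trans (*-comm (ℕ→ℚ (suc d)) (frac 1 (suc d))) (frac-*-denominator 1 d)

  *-cancelʳ-≢0 : ∀ x y c → c ≢ 0ℚ → x * c ≡ y * c → x ≡ y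
  *-cancelʳ-≢0 x y c c≢0 e = begin
    x ≡⟨ sym (*-identityʳ x) ⟩
    x * 1ℚ ≡⟨ cong (x *_) (sym (*-inverseʳ c)) ⟩
    x * (c * 1/ c) ≡⟨ sym (*-assoc x c _) ⟩
    (x * c) * 1/ c ≡⟨ cong (_* 1/ c) e ⟩
    (y * c) * 1/ c ≡⟨ *-assoc y c _ ⟩
    y * (c * 1/ c) ≡⟨ cong (y *_) (*-inverseʳ c) ⟩
    y * 1ℚ ≡⟨ *-identityʳ y ⟩
    y ∎
    where open ≡-Reasoning
          instance _ = ≢-nonZero c≢0

  *-≢0 : ∀ x y → x ≢ 0ℚ → y ≢ 0ℚ → x * y ≢ 0ℚ
  *-≢0 x y hx hy e = hx (*-cancelʳ-≢0 x 0ℚ y hy (trans e (sym (*-zeroˡ y))))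

  ℕ→ℚ-suc*x≡0⇒x≡0 : ∀ k v → ℕ→ℚ (suc k) * v ≡ 0ℚ → v ≡ 0ℚ
  ℕ→ℚ-suc*x≡0⇒x≡0 k v e = *-cancelʳ-≢0 v 0ℚ (ℕ→ℚ (suc k)) (ℕ→ℚ-suc≢0 k)
    (trans (*-comm v (ℕ→ℚ (suc k))) (trans e (sym (*-zeroˡ (ℕ→ℚ (suc k))))))

  p-q≡0⇒p≡q : ∀ p q → p - q ≡ 0ℚ → p ≡ q
  p-q≡0⇒p≡q p q e = trans (solve 2 (λ p q → p := (p :- q) :+ q) refl p q) (trans (cong (_+ q) e) (+-identityˡ q))

  ℕ→ℚ-*-suc-pred : ∀ p (H : ℕ → ℚ) → ℕ→ℚ p * H (suc (p ∸ 1)) ≡ ℕ→ℚ p * H p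
  ℕ→ℚ-*-suc-pred zero H = trans (*-zeroˡ (H 1)) (sym (*-zeroˡ (H 0)))
  ℕ→ℚ-*-suc-pred (suc p) H = refl

  2+n≢n : ∀ i → suc (suc i) ≢ i
  2+n≢n zero ()
  2+n≢n (suc i) e = 2+n≢n i (ℕP.suc-injective e)

  ≡⇒≡ᵇ-true : ∀ k j → k ≡ j → (k ≡ᵇ j) ≡ true
  ≡⇒≡ᵇ-true k j e = Equivalence.to T-≡ (ℕP.≡⇒≡ᵇ k j e)

  ≢⇒≡ᵇ-false : ∀ k j → k ≢ j → (k ≡ᵇ j) ≡ false
  ≢⇒≡ᵇ-false k j ne = ¬-not (λ e → ne (ℕP.≡ᵇ⇒≡ k j (Equivalence.from T-≡ e)))

  <⇒<ᵇ-true : ∀ {k j} → k < j → (k <ᵇ j) ≡ true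
  <⇒<ᵇ-true h = Equivalence.to T-≡ (ℕP.<⇒<ᵇ h)

  ≮⇒<ᵇ-false : ∀ k j → ¬ k < j → (k <ᵇ j) ≡ false
  ≮⇒<ᵇ-false k j ne = ¬-not (λ e → ne (ℕP.<ᵇ⇒< k j (Equivalence.from T-≡ e)))

  ≤ᵇ-false⇒≰ : ∀ a b → (a ≤ᵇ b) ≡ false → ¬ a ≤ b
  ≤ᵇ-false⇒≰ a b e h = subst T e (ℕP.≤⇒≤ᵇ h)

  if-* : ∀ (b : Bool) (c v : ℚ) → (if b then c * v else 0ℚ) ≡ c * (if b then v else 0ℚ)
  if-* true c v = refl
  if-* false c v = sym (*-zeroʳ c)

  if-0 : ∀ (a : Bool) → (if a then 0ℚ else 0ℚ) ≡ 0ℚ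
  if-0 true = refl
  if-0 false = refl

  if-minus : ∀ (b : Bool) (u v : ℚ) → (if b then u - v else 0ℚ) ≡ (if b then u else 0ℚ) - (if b then v else 0ℚ)
  if-minus true u v = refl
  if-minus false u v = sym (+-inverseʳ 0ℚ)

  -- Finite sums

  sumOver : ∀ {I : Set} → List I → (I → ℚ) → ℚ
  sumOver L F = sumℚ (map F L)

  sumOver-cong : ∀ {I : Set} (L : List I) {F G : I → ℚ} → (∀ x → F x ≡ G x) → sumOver L F ≡ sumOver L G
  sumOver-cong [] e = refl
  sumOver-cong (x ∷ L) e = cong₂ _+_ (e x) (sumOver-cong L e)

  sumOver-+ : ∀ {I : Set} (L : List I) (F G : I → ℚ) → sumOver L (λ x → F x + G x) ≡ sumOver L F + sumOver L G
  sumOver-+ [] F G = refl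
  sumOver-+ (x ∷ L) F G = trans (cong (λ k → (F x + G x) + k) (sumOver-+ L F G))
    (solve 4 (λ a b c d → (a :+ b) :+ (c :+ d) := (a :+ c) :+ (b :+ d)) refl (F x) (G x) (sumOver L F) (sumOver L G))

  sumOver-* : ∀ {I : Set} (L : List I) c (F : I → ℚ) → sumOver L (λ x → c * F x) ≡ c * sumOver L F
  sumOver-* [] c F = sym (*-zeroʳ c)
  sumOver-* (x ∷ L) c F = trans (cong (λ k → c * F x + k) (sumOver-* L c F)) (sym (*-distribˡ-+ c (F x) (sumOver L F)))

  sumOver-0 : ∀ {I : Set} (L : List I) → sumOver L (λ _ → 0ℚ) ≡ 0ℚ
  sumOver-0 [] = refl
  sumOver-0 (x ∷ L) = trans (+-identityˡ (sumOver L (λ _ → 0ℚ))) (sumOver-0 L)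

  sumOver-≡0 : ∀ {I : Set} (L : List I) (F : I → ℚ) → (∀ x → F x ≡ 0ℚ) → sumOver L F ≡ 0ℚ
  sumOver-≡0 L F e = trans (sumOver-cong L e) (sumOver-0 L)

  sumOver-neg : ∀ {I : Set} (L : List I) (F : I → ℚ) → sumOver L (λ x → - F x) ≡ - sumOver L F
  sumOver-neg [] F = refl
  sumOver-neg (x ∷ L) F = trans (cong (λ k → - F x + k) (sumOver-neg L F)) (sym (neg-distrib-+ (F x) (sumOver L F)))

  sumOver-minus : ∀ {I : Set} (L : List I) (F G : I → ℚ) → sumOver L (λ x → F x - G x) ≡ sumOver L F - sumOver L G
  sumOver-minus L F G = trans (sumOver-+ L F (λ x → - G x)) (cong (λ k → sumOver L F + k) (sumOver-neg L G))

  sumOver-++ : ∀ {I : Set} (L₁ L₂ : List I) (F : I → ℚ) → sumOver (L₁ ++ L₂) F ≡ sumOver L₁ F + sumOver L₂ F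
  sumOver-++ [] L₂ F = sym (+-identityˡ (sumOver L₂ F))
  sumOver-++ (x ∷ L₁) L₂ F = trans (cong (λ k → F x + k) (sumOver-++ L₁ L₂ F)) (sym (+-assoc (F x) (sumOver L₁ F) (sumOver L₂ F)))

  sumOver-map : ∀ {I J : Set} (g : J → I) (L : List J) (F : I → ℚ) → sumOver (map g L) F ≡ sumOver L (F ∘ g)
  sumOver-map g [] F = refl
  sumOver-map g (x ∷ L) F = cong (λ k → F (g x) + k) (sumOver-map g L F)

  sumOver-comm : ∀ {I J : Set} (L₁ : List I) (L₂ : List J) (F : I → J → ℚ) →
    sumOver L₁ (λ x → sumOver L₂ (F x)) ≡ sumOver L₂ (λ z → sumOver L₁ (λ x → F x z))
  sumOver-comm [] L₂ F = sym (sumOver-0 L₂)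
  sumOver-comm (x ∷ L₁) L₂ F = trans (cong (λ k → sumOver L₂ (F x) + k) (sumOver-comm L₁ L₂ F))
    (sym (sumOver-+ L₂ (F x) (λ z → sumOver L₁ (λ x → F x z))))

  sumPts : ∀ n → Fn n → ℚ
  sumPts n F = sumOver (allPts n) F

  sumPts-suc : ∀ n (F : Fn (suc n)) → sumPts (suc n) F ≡ sumPts n (λ x → F (false ∷ x)) + sumPts n (λ x → F (true ∷ x))
  sumPts-suc n F = trans (sumOver-++ (map (false ∷_) (allPts n)) (map (true ∷_) (allPts n)) F)
    (cong₂ _+_ (sumOver-map (false ∷_) (allPts n) F) (sumOver-map (true ∷_) (allPts n) F))

  -- Intersection counts

  inter : ∀ {n} → Subset n → Subset n → ℕ
  inter [] [] = 0
  inter (true ∷ x) (true ∷ y) = suc (inter x y)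
  inter (true ∷ x) (false ∷ y) = inter x y
  inter (false ∷ x) (true ∷ y) = inter x y
  inter (false ∷ x) (false ∷ y) = inter x y

  diff : ∀ {n} → Subset n → Subset n → ℕ
  diff [] [] = 0
  diff (true ∷ x) (true ∷ y) = diff x y
  diff (true ∷ x) (false ∷ y) = suc (diff x y)
  diff (false ∷ x) (true ∷ y) = diff x y
  diff (false ∷ x) (false ∷ y) = diff x y

  outside : ∀ {n} → Subset n → Subset n → ℕ
  outside [] [] = 0
  outside (true ∷ x) (true ∷ y) = outside x y
  outside (true ∷ x) (false ∷ y) = outside x y
  outside (false ∷ x) (true ∷ y) = outside x y
  outside (false ∷ x) (false ∷ y) = suc (outside x y)

  subsetᵇ : ∀ {n} → Subset n → Subset n → Bool
  subsetᵇ [] [] = true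
  subsetᵇ (true ∷ x) (true ∷ y) = subsetᵇ x y
  subsetᵇ (true ∷ x) (false ∷ y) = false
  subsetᵇ (false ∷ x) (true ∷ y) = subsetᵇ x y
  subsetᵇ (false ∷ x) (false ∷ y) = subsetᵇ x y

  ∣x∣≡inter+diff : ∀ {n} (x y : Subset n) → ∣ x ∣ ≡ inter x y ℕ.+ diff x y
  ∣x∣≡inter+diff [] [] = refl
  ∣x∣≡inter+diff (true ∷ x) (true ∷ y) = cong suc (∣x∣≡inter+diff x y)
  ∣x∣≡inter+diff (true ∷ x) (false ∷ y) = trans (cong suc (∣x∣≡inter+diff x y)) (sym (ℕP.+-suc _ _))
  ∣x∣≡inter+diff (false ∷ x) (true ∷ y) = ∣x∣≡inter+diff x y
  ∣x∣≡inter+diff (false ∷ x) (false ∷ y) = ∣x∣≡inter+diff x y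

  inter-comm : ∀ {n} (x y : Subset n) → inter x y ≡ inter y x
  inter-comm [] [] = refl
  inter-comm (true ∷ x) (true ∷ y) = cong suc (inter-comm x y)
  inter-comm (true ∷ x) (false ∷ y) = inter-comm x y
  inter-comm (false ∷ x) (true ∷ y) = inter-comm x y
  inter-comm (false ∷ x) (false ∷ y) = inter-comm x y

  ∣y∣≡inter+diff : ∀ {n} (x y : Subset n) → ∣ y ∣ ≡ inter x y ℕ.+ diff y x
  ∣y∣≡inter+diff x y = trans (∣x∣≡inter+diff y x) (cong (ℕ._+ diff y x) (inter-comm y x))

  dist≡diff+diff : ∀ {n} (x y : Subset n) → dist x y ≡ diff x y ℕ.+ diff y x
  dist≡diff+diff [] [] = refl
  dist≡diff+diff (true ∷ x) (true ∷ y) = dist≡diff+diff x y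
  dist≡diff+diff (true ∷ x) (false ∷ y) = cong suc (dist≡diff+diff x y)
  dist≡diff+diff (false ∷ x) (true ∷ y) = trans (cong suc (dist≡diff+diff x y)) (sym (ℕP.+-suc _ _))
  dist≡diff+diff (false ∷ x) (false ∷ y) = dist≡diff+diff x y

  n≡inter+diff+diff+outside : ∀ {n} (x y : Subset n) → n ≡ inter x y ℕ.+ diff x y ℕ.+ diff y x ℕ.+ outside x y
  n≡inter+diff+diff+outside [] [] = refl
  n≡inter+diff+diff+outside {suc n} (true ∷ x) (true ∷ y) = cong suc (n≡inter+diff+diff+outside x y)
  n≡inter+diff+diff+outside {suc n} (true ∷ x) (false ∷ y) = trans (cong suc (n≡inter+diff+diff+outside x y))
    (cong (λ k → k ℕ.+ diff y x ℕ.+ outside x y) (sym (ℕP.+-suc (inter x y) (diff x y))))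
  n≡inter+diff+diff+outside {suc n} (false ∷ x) (true ∷ y) = trans (cong suc (n≡inter+diff+diff+outside x y))
    (cong (ℕ._+ outside x y) (sym (ℕP.+-suc (inter x y ℕ.+ diff x y) (diff y x))))
  n≡inter+diff+diff+outside {suc n} (false ∷ x) (false ∷ y) = trans (cong suc (n≡inter+diff+diff+outside x y)) (sym (ℕP.+-suc _ (outside x y)))

  does-⊆?≡subsetᵇ : ∀ {n} (z x : Subset n) → does (z ⊆? x) ≡ subsetᵇ z x
  does-⊆?≡subsetᵇ [] [] = refl
  does-⊆?≡subsetᵇ (true ∷ z) (true ∷ x) = does-⊆?≡subsetᵇ z x
  does-⊆?≡subsetᵇ (true ∷ z) (false ∷ x) = refl
  does-⊆?≡subsetᵇ (false ∷ z) (true ∷ x) = does-⊆?≡subsetᵇ z x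
  does-⊆?≡subsetᵇ (false ∷ z) (false ∷ x) = does-⊆?≡subsetᵇ z x

  ⊆⇒subsetᵇ : ∀ {n} (z x : Subset n) → z ⊆ x → subsetᵇ z x ≡ true
  ⊆⇒subsetᵇ z x h with z ⊆? x | does-⊆?≡subsetᵇ z x
  ... | yes _ | e = sym e
  ... | no ¬h | _ = ⊥-elim (¬h h)

  subsetᵇ⇒diff≡0 : ∀ {n} (z x : Subset n) → subsetᵇ z x ≡ true → diff z x ≡ 0
  subsetᵇ⇒diff≡0 [] [] e = refl
  subsetᵇ⇒diff≡0 (true ∷ z) (true ∷ x) e = subsetᵇ⇒diff≡0 z x e
  subsetᵇ⇒diff≡0 (false ∷ z) (true ∷ x) e = subsetᵇ⇒diff≡0 z x e
  subsetᵇ⇒diff≡0 (false ∷ z) (false ∷ x) e = subsetᵇ⇒diff≡0 z x e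

  diff≡0⇒subsetᵇ : ∀ {n} (z x : Subset n) → diff z x ≡ 0 → subsetᵇ z x ≡ true
  diff≡0⇒subsetᵇ [] [] e = refl
  diff≡0⇒subsetᵇ (true ∷ z) (true ∷ x) e = diff≡0⇒subsetᵇ z x e
  diff≡0⇒subsetᵇ (false ∷ z) (true ∷ x) e = diff≡0⇒subsetᵇ z x e
  diff≡0⇒subsetᵇ (false ∷ z) (false ∷ x) e = diff≡0⇒subsetᵇ z x e

  inter≤∣∣ʳ : ∀ {m} (w z : Subset m) → inter w z ≤ ∣ z ∣
  inter≤∣∣ʳ [] [] = z≤n
  inter≤∣∣ʳ (true ∷ w) (true ∷ z) = s≤s (inter≤∣∣ʳ w z)
  inter≤∣∣ʳ (true ∷ w) (false ∷ z) = inter≤∣∣ʳ w z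
  inter≤∣∣ʳ (false ∷ w) (true ∷ z) = ℕP.m≤n⇒m≤1+n (inter≤∣∣ʳ w z)
  inter≤∣∣ʳ (false ∷ w) (false ∷ z) = inter≤∣∣ʳ w z

  inter≤∣∣ˡ : ∀ {n} (x y : Subset n) → inter x y ≤ ∣ x ∣
  inter≤∣∣ˡ x y = subst (inter x y ≤_) (sym (∣x∣≡inter+diff x y)) (ℕP.m≤m+n _ _)

  subsetᵇ⇒inter≡∣∣ : ∀ {n} (x y : Subset n) → subsetᵇ y x ≡ true → inter x y ≡ ∣ y ∣
  subsetᵇ⇒inter≡∣∣ x y e = sym (trans (∣y∣≡inter+diff x y) (trans (cong (inter x y ℕ.+_) (subsetᵇ⇒diff≡0 y x e)) (ℕP.+-identityʳ _)))

  inter≡∣∣⇒subsetᵇ : ∀ {n} (x y : Subset n) → inter x y ≡ ∣ y ∣ → subsetᵇ y x ≡ true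
  inter≡∣∣⇒subsetᵇ x y e = diff≡0⇒subsetᵇ y x
    (ℕP.+-cancelˡ-≡ (inter x y) _ _ (trans (sym (∣y∣≡inter+diff x y)) (trans (sym e) (sym (ℕP.+-identityʳ _)))))

  subsetᵇ≡inter≡ᵇ∣∣ : ∀ {m} (z w : Subset m) → subsetᵇ z w ≡ (inter w z ≡ᵇ ∣ z ∣)
  subsetᵇ≡inter≡ᵇ∣∣ [] [] = refl
  subsetᵇ≡inter≡ᵇ∣∣ (true ∷ z) (true ∷ w) = subsetᵇ≡inter≡ᵇ∣∣ z w
  subsetᵇ≡inter≡ᵇ∣∣ (true ∷ z) (false ∷ w) = sym (≢⇒≡ᵇ-false _ _ (λ e → ℕP.<-irrefl e (s≤s (inter≤∣∣ʳ w z))))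
  subsetᵇ≡inter≡ᵇ∣∣ (false ∷ z) (true ∷ w) = subsetᵇ≡inter≡ᵇ∣∣ z w
  subsetᵇ≡inter≡ᵇ∣∣ (false ∷ z) (false ∷ w) = subsetᵇ≡inter≡ᵇ∣∣ z w

  subsetᵇ⇒∣∣-≤ : ∀ {m} (z y : Subset m) → subsetᵇ z y ≡ true → ∣ z ∣ ≤ ∣ y ∣
  subsetᵇ⇒∣∣-≤ [] [] e = z≤n
  subsetᵇ⇒∣∣-≤ (true ∷ z) (true ∷ y) e = s≤s (subsetᵇ⇒∣∣-≤ z y e)
  subsetᵇ⇒∣∣-≤ (false ∷ z) (true ∷ y) e = ℕP.m≤n⇒m≤1+n (subsetᵇ⇒∣∣-≤ z y e)
  subsetᵇ⇒∣∣-≤ (false ∷ z) (false ∷ y) e = subsetᵇ⇒∣∣-≤ z y e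

  ∣∩∣≡inter : ∀ {m} (x y : Subset m) → ∣ x ∩ y ∣ ≡ inter x y
  ∣∩∣≡inter [] [] = refl
  ∣∩∣≡inter (true ∷ x) (true ∷ y) = cong suc (∣∩∣≡inter x y)
  ∣∩∣≡inter (true ∷ x) (false ∷ y) = ∣∩∣≡inter x y
  ∣∩∣≡inter (false ∷ x) (true ∷ y) = ∣∩∣≡inter x y
  ∣∩∣≡inter (false ∷ x) (false ∷ y) = ∣∩∣≡inter x y

  ∩-subsetᵇʳ : ∀ {m} (x y : Subset m) → subsetᵇ (x ∩ y) y ≡ true
  ∩-subsetᵇʳ [] [] = refl
  ∩-subsetᵇʳ (true ∷ x) (true ∷ y) = ∩-subsetᵇʳ x y
  ∩-subsetᵇʳ (true ∷ x) (false ∷ y) = ∩-subsetᵇʳ x y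
  ∩-subsetᵇʳ (false ∷ x) (true ∷ y) = ∩-subsetᵇʳ x y
  ∩-subsetᵇʳ (false ∷ x) (false ∷ y) = ∩-subsetᵇʳ x y

  ∩-subsetᵇˡ : ∀ {m} (x y : Subset m) → subsetᵇ (x ∩ y) x ≡ true
  ∩-subsetᵇˡ [] [] = refl
  ∩-subsetᵇˡ (true ∷ x) (true ∷ y) = ∩-subsetᵇˡ x y
  ∩-subsetᵇˡ (true ∷ x) (false ∷ y) = ∩-subsetᵇˡ x y
  ∩-subsetᵇˡ (false ∷ x) (true ∷ y) = ∩-subsetᵇˡ x y
  ∩-subsetᵇˡ (false ∷ x) (false ∷ y) = ∩-subsetᵇˡ x y

  subsetᵇ-∩⇒inter-≤ : ∀ {m} (x y x' : Subset m) → subsetᵇ (x ∩ y) x' ≡ true → inter x y ≤ inter x' y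
  subsetᵇ-∩⇒inter-≤ [] [] [] e = z≤n
  subsetᵇ-∩⇒inter-≤ (true ∷ x) (true ∷ y) (true ∷ x') e = s≤s (subsetᵇ-∩⇒inter-≤ x y x' e)
  subsetᵇ-∩⇒inter-≤ (true ∷ x) (false ∷ y) (c ∷ x') e with c
  ... | true = subsetᵇ-∩⇒inter-≤ x y x' e
  ... | false = subsetᵇ-∩⇒inter-≤ x y x' e
  subsetᵇ-∩⇒inter-≤ (false ∷ x) (true ∷ y) (c ∷ x') e with c
  ... | true = ℕP.m≤n⇒m≤1+n (subsetᵇ-∩⇒inter-≤ x y x' e)
  ... | false = subsetᵇ-∩⇒inter-≤ x y x' e
  subsetᵇ-∩⇒inter-≤ (false ∷ x) (false ∷ y) (c ∷ x') e with c
  ... | true = subsetᵇ-∩⇒inter-≤ x y x' e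
  ... | false = subsetᵇ-∩⇒inter-≤ x y x' e

  subsetᵇ-∩ : ∀ {m} (z x y : Subset m) → subsetᵇ z (x ∩ y) ≡ (subsetᵇ z x ∧ subsetᵇ z y)
  subsetᵇ-∩ [] [] [] = refl
  subsetᵇ-∩ (false ∷ z) (true ∷ x) (true ∷ y) = subsetᵇ-∩ z x y
  subsetᵇ-∩ (false ∷ z) (true ∷ x) (false ∷ y) = subsetᵇ-∩ z x y
  subsetᵇ-∩ (false ∷ z) (false ∷ x) (true ∷ y) = subsetᵇ-∩ z x y
  subsetᵇ-∩ (false ∷ z) (false ∷ x) (false ∷ y) = subsetᵇ-∩ z x y
  subsetᵇ-∩ (true ∷ z) (true ∷ x) (true ∷ y) = subsetᵇ-∩ z x y
  subsetᵇ-∩ (true ∷ z) (true ∷ x) (false ∷ y) = sym (∧-zeroʳ (subsetᵇ z x))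
  subsetᵇ-∩ (true ∷ z) (false ∷ x) (true ∷ y) = refl
  subsetᵇ-∩ (true ∷ z) (false ∷ x) (false ∷ y) = refl

  superset-of-size : ∀ {m} (y : Subset m) k → ∣ y ∣ ≤ k → k ≤ m → ∃ λ x → subsetᵇ y x ≡ true × ∣ x ∣ ≡ k
  superset-of-size [] zero _ _ = [] , refl , refl
  superset-of-size (true ∷ y) (suc k) (s≤s yk) (s≤s km) with superset-of-size y k yk km
  ... | x , e1 , e2 = true ∷ x , e1 , cong suc e2
  superset-of-size {suc m} (false ∷ y) k yk km with k ℕP.≤? m
  ... | yes k≤m with superset-of-size y k yk k≤m
  ...   | x , e1 , e2 = false ∷ x , e1 , e2
  superset-of-size {suc m} (false ∷ y) k yk km | no k≰m with superset-of-size y m (∣p∣≤n y) ℕP.≤-refl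
  ...   | x , e1 , e2 = true ∷ x , e1 , trans (cong suc e2) (ℕP.≤-antisym (ℕP.≰⇒> k≰m) km)

  dist-comm : ∀ {m} (x w : Subset m) → dist x w ≡ dist w x
  dist-comm x w = trans (dist≡diff+diff x w) (trans (ℕP.+-comm (diff x w) (diff w x)) (sym (dist≡diff+diff w x)))

  dist-refl : ∀ {m} (v : Subset m) → dist v v ≡ 0
  dist-refl [] = refl
  dist-refl (true ∷ v) = dist-refl v
  dist-refl (false ∷ v) = dist-refl v

  dist≡0⇒≡ : ∀ {m} (a b : Subset m) → dist a b ≡ 0 → a ≡ b
  dist≡0⇒≡ [] [] e = refl
  dist≡0⇒≡ (true ∷ a) (true ∷ b) e = cong (true ∷_) (dist≡0⇒≡ a b e)
  dist≡0⇒≡ (false ∷ a) (false ∷ b) e = cong (false ∷_) (dist≡0⇒≡ a b e)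

  m+m≡n+n⇒m≡n : ∀ p q → p ℕ.+ p ≡ q ℕ.+ q → p ≡ q
  m+m≡n+n⇒m≡n zero zero e = refl
  m+m≡n+n⇒m≡n zero (suc q) ()
  m+m≡n+n⇒m≡n (suc p) zero ()
  m+m≡n+n⇒m≡n (suc p) (suc q) e = cong suc (m+m≡n+n⇒m≡n p q (ℕP.suc-injective (trans (sym (ℕP.+-suc p p)) (trans (ℕP.suc-injective e) (ℕP.+-suc q q)))))

  ≡dist⇒≡inter : ∀ {n} (x x' y : Subset n) → ∣ x ∣ ≡ ∣ x' ∣ → dist x y ≡ dist x' y → inter x y ≡ inter x' y
  ≡dist⇒≡inter x x' y e1 e2 = m+m≡n+n⇒m≡n _ _ (ℕP.+-cancelʳ-≡ (b' ℕ.+ a') _ _ (trans (cong ((p ℕ.+ p) ℕ.+_) (sym h3)) h))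
    where
    p = inter x y ; b = diff x y ; a = diff y x
    p' = inter x' y ; b' = diff x' y ; a' = diff y x'
    h1 : p ℕ.+ b ≡ p' ℕ.+ b'
    h1 = trans (sym (∣x∣≡inter+diff x y)) (trans e1 (∣x∣≡inter+diff x' y))
    h2 : p ℕ.+ a ≡ p' ℕ.+ a'
    h2 = trans (sym (∣y∣≡inter+diff x y)) (∣y∣≡inter+diff x' y)
    h3 : b ℕ.+ a ≡ b' ℕ.+ a'
    h3 = trans (sym (dist≡diff+diff x y)) (trans e2 (dist≡diff+diff x' y))
    rearr : ∀ p b a → (p ℕ.+ p) ℕ.+ (b ℕ.+ a) ≡ (p ℕ.+ b) ℕ.+ (p ℕ.+ a)
    rearr p b a = interchange p p b a
    h : (p ℕ.+ p) ℕ.+ (b ℕ.+ a) ≡ (p' ℕ.+ p') ℕ.+ (b' ℕ.+ a')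
    h = trans (rearr p b a) (trans (cong₂ ℕ._+_ h1 h2) (sym (rearr p' b' a')))

  ≡inter⇒≡diff : ∀ {n} (z x x' : Subset n) → ∣ x ∣ ≡ ∣ x' ∣ → inter x z ≡ inter x' z → diff x z ≡ diff x' z
  ≡inter⇒≡diff z x x' e1 e2 = ℕP.+-cancelˡ-≡ (inter x z) _ _
    (trans (sym (∣x∣≡inter+diff x z)) (trans e1 (trans (∣x∣≡inter+diff x' z) (cong (ℕ._+ diff x' z) (sym e2)))))

  ≡inter⇒≡dist : ∀ {n} (z x x' : Subset n) → ∣ x ∣ ≡ ∣ x' ∣ → inter x z ≡ inter x' z → dist x z ≡ dist x' z
  ≡inter⇒≡dist z x x' e1 e2 = trans (dist≡diff+diff x z) (trans (cong₂ ℕ._+_ (≡inter⇒≡diff z x x' e1 e2)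
    (ℕP.+-cancelˡ-≡ (inter x z) _ _ (trans (sym (∣y∣≡inter+diff x z)) (trans (∣y∣≡inter+diff x' z) (cong (ℕ._+ diff z x') (sym e2))))))
    (sym (dist≡diff+diff x' z)))

  -- Neighbour sums

  neighbourSum : ∀ {n} → Fn n → Subset n → ℚ
  neighbourSum F [] = 0ℚ
  neighbourSum F (c ∷ x) = F (not c ∷ x) + neighbourSum (λ x' → F (c ∷ x')) x

  neighbourSum-cong : ∀ {m} (F G : Fn m) → (∀ w → F w ≡ G w) → ∀ x → neighbourSum F x ≡ neighbourSum G x
  neighbourSum-cong F G e [] = refl
  neighbourSum-cong F G e (c ∷ x) = cong₂ _+_ (e _) (neighbourSum-cong _ _ (λ w → e (c ∷ w)) x)

  sumPts-dist≡0 : ∀ {n} (x : Subset n) (F : Fn n) → sumPts n (λ x' → if dist x x' ≡ᵇ 0 then F x' else 0ℚ) ≡ F x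
  sumPts-dist≡0 [] F = +-identityʳ (F [])
  sumPts-dist≡0 {suc n} (true ∷ x) F = trans (sumPts-suc n _)
    (trans (cong₂ _+_ (sumOver-0 (allPts n)) (sumPts-dist≡0 x (λ x' → F (true ∷ x')))) (+-identityˡ (F (true ∷ x))))
  sumPts-dist≡0 {suc n} (false ∷ x) F = trans (sumPts-suc n _)
    (trans (cong₂ _+_ (sumPts-dist≡0 x (λ x' → F (false ∷ x'))) (sumOver-0 (allPts n))) (+-identityʳ (F (false ∷ x))))

  sumPts-dist≡1 : ∀ {n} (x : Subset n) (F : Fn n) → sumPts n (λ x' → if dist x x' ≡ᵇ 1 then F x' else 0ℚ) ≡ neighbourSum F x
  sumPts-dist≡1 [] F = refl
  sumPts-dist≡1 {suc n} (true ∷ x) F = trans (sumPts-suc n _)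
    (cong₂ _+_ (sumPts-dist≡0 x (λ x' → F (false ∷ x'))) (sumPts-dist≡1 x (λ x' → F (true ∷ x'))))
  sumPts-dist≡1 {suc n} (false ∷ x) F = trans (sumPts-suc n _)
    (trans (cong₂ _+_ (sumPts-dist≡1 x (λ x' → F (false ∷ x'))) (sumPts-dist≡0 x (λ x' → F (true ∷ x'))))
     (+-comm (neighbourSum (λ x' → F (false ∷ x')) x) (F (true ∷ x))))

  -- The neighbour sum at x of a function G (∣ x' ∩ y ∣) (∣ x' ∖ y ∣), where A, P, B, E count the
  -- coordinates in y ∖ x, x ∩ y, x ∖ y and outside x ∪ y.
  neighbourCount : (G : ℕ → ℕ → ℚ) (A P B E : ℕ) → ℚ
  neighbourCount G A P B E = ℕ→ℚ A * G (suc P) B + ℕ→ℚ P * G (P ∸ 1) B + ℕ→ℚ B * G P (B ∸ 1) + ℕ→ℚ E * G P (suc B)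

  neighbourCount-sucP : ∀ G A P B E → G P B + neighbourCount (λ p → G (suc p)) A P B E ≡ neighbourCount G A (suc P) B E
  neighbourCount-sucP G A P B E = begin
    G P B + (a * G (suc (suc P)) B + p * G (suc (P ∸ 1)) B + b * G (suc P) (B ∸ 1) + e * G (suc P) (suc B))
      ≡⟨ cong (λ k → G P B + (a * G (suc (suc P)) B + k + b * G (suc P) (B ∸ 1) + e * G (suc P) (suc B))) (ℕ→ℚ-*-suc-pred P (λ q → G q B)) ⟩
    G P B + (a * G (suc (suc P)) B + p * G P B + b * G (suc P) (B ∸ 1) + e * G (suc P) (suc B))
      ≡⟨ solve 8 (λ g a g₁ p b g₂ e g₃ → g :+ (a :* g₁ :+ p :* g :+ b :* g₂ :+ e :* g₃) := a :* g₁ :+ (con 1ℚ :+ p) :* g :+ b :* g₂ :+ e :* g₃) refl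
          (G P B) a (G (suc (suc P)) B) p b (G (suc P) (B ∸ 1)) e (G (suc P) (suc B)) ⟩
    a * G (suc (suc P)) B + (1ℚ + p) * G P B + b * G (suc P) (B ∸ 1) + e * G (suc P) (suc B)
      ≡⟨ cong (λ k → a * G (suc (suc P)) B + k * G P B + b * G (suc P) (B ∸ 1) + e * G (suc P) (suc B)) (sym (ℕ→ℚ-suc P)) ⟩
    neighbourCount G A (suc P) B E ∎
    where open ≡-Reasoning
          a = ℕ→ℚ A ; p = ℕ→ℚ P ; b = ℕ→ℚ B ; e = ℕ→ℚ E

  neighbourCount-sucB : ∀ G A P B E → G P B + neighbourCount (λ p q → G p (suc q)) A P B E ≡ neighbourCount G A P (suc B) E
  neighbourCount-sucB G A P B E = begin
    G P B + (a * G (suc P) (suc B) + p * G (P ∸ 1) (suc B) + b * G P (suc (B ∸ 1)) + e * G P (suc (suc B)))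
      ≡⟨ cong (λ k → G P B + (a * G (suc P) (suc B) + p * G (P ∸ 1) (suc B) + k + e * G P (suc (suc B)))) (ℕ→ℚ-*-suc-pred B (G P)) ⟩
    G P B + (a * G (suc P) (suc B) + p * G (P ∸ 1) (suc B) + b * G P B + e * G P (suc (suc B)))
      ≡⟨ solve 8 (λ g a g₁ p g₂ b e g₃ → g :+ (a :* g₁ :+ p :* g₂ :+ b :* g :+ e :* g₃) := a :* g₁ :+ p :* g₂ :+ (con 1ℚ :+ b) :* g :+ e :* g₃) refl
          (G P B) a (G (suc P) (suc B)) p (G (P ∸ 1) (suc B)) b e (G P (suc (suc B))) ⟩
    a * G (suc P) (suc B) + p * G (P ∸ 1) (suc B) + (1ℚ + b) * G P B + e * G P (suc (suc B))
      ≡⟨ cong (λ k → a * G (suc P) (suc B) + p * G (P ∸ 1) (suc B) + k * G P B + e * G P (suc (suc B))) (sym (ℕ→ℚ-suc B)) ⟩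
    neighbourCount G A P (suc B) E ∎
    where open ≡-Reasoning
          a = ℕ→ℚ A ; p = ℕ→ℚ P ; b = ℕ→ℚ B ; e = ℕ→ℚ E

  neighbourCount-sucA : ∀ G A P B E → G (suc P) B + neighbourCount G A P B E ≡ neighbourCount G (suc A) P B E
  neighbourCount-sucA G A P B E = begin
    G (suc P) B + (a * G (suc P) B + p * G (P ∸ 1) B + b * G P (B ∸ 1) + e * G P (suc B))
      ≡⟨ solve 8 (λ g a p g₂ b g₃ e g₄ → g :+ (a :* g :+ p :* g₂ :+ b :* g₃ :+ e :* g₄) := (con 1ℚ :+ a) :* g :+ p :* g₂ :+ b :* g₃ :+ e :* g₄) refl
          (G (suc P) B) a p (G (P ∸ 1) B) b (G P (B ∸ 1)) e (G P (suc B)) ⟩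
    (1ℚ + a) * G (suc P) B + p * G (P ∸ 1) B + b * G P (B ∸ 1) + e * G P (suc B)
      ≡⟨ cong (λ k → k * G (suc P) B + p * G (P ∸ 1) B + b * G P (B ∸ 1) + e * G P (suc B)) (sym (ℕ→ℚ-suc A)) ⟩
    neighbourCount G (suc A) P B E ∎
    where open ≡-Reasoning
          a = ℕ→ℚ A ; p = ℕ→ℚ P ; b = ℕ→ℚ B ; e = ℕ→ℚ E

  neighbourCount-sucE : ∀ G A P B E → G P (suc B) + neighbourCount G A P B E ≡ neighbourCount G A P B (suc E)
  neighbourCount-sucE G A P B E = begin
    G P (suc B) + (a * G (suc P) B + p * G (P ∸ 1) B + b * G P (B ∸ 1) + e * G P (suc B))
      ≡⟨ solve 8 (λ g a g₁ p g₂ b g₃ e → g :+ (a :* g₁ :+ p :* g₂ :+ b :* g₃ :+ e :* g) := a :* g₁ :+ p :* g₂ :+ b :* g₃ :+ (con 1ℚ :+ e) :* g) refl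
          (G P (suc B)) a (G (suc P) B) p (G (P ∸ 1) B) b (G P (B ∸ 1)) e ⟩
    a * G (suc P) B + p * G (P ∸ 1) B + b * G P (B ∸ 1) + (1ℚ + e) * G P (suc B)
      ≡⟨ cong (λ k → a * G (suc P) B + p * G (P ∸ 1) B + b * G P (B ∸ 1) + k * G P (suc B)) (sym (ℕ→ℚ-suc E)) ⟩
    neighbourCount G A P B (suc E) ∎
    where open ≡-Reasoning
          a = ℕ→ℚ A ; p = ℕ→ℚ P ; b = ℕ→ℚ B ; e = ℕ→ℚ E

  neighbourSum-profile : ∀ {n} (x y : Subset n) (G : ℕ → ℕ → ℚ) →
    neighbourSum (λ x' → G (inter x' y) (diff x' y)) x ≡ neighbourCount G (diff y x) (inter x y) (diff x y) (outside x y)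
  neighbourSum-profile [] [] G = sym (solve 4 (λ a b c d → con 0ℚ :* a :+ con 0ℚ :* b :+ con 0ℚ :* c :+ con 0ℚ :* d := con 0ℚ) refl
    (G 1 0) (G 0 0) (G 0 0) (G 0 1))
  neighbourSum-profile (true ∷ x) (true ∷ y) G =
    trans (cong (λ k → G (inter x y) (diff x y) + k) (neighbourSum-profile x y (λ p → G (suc p)))) (neighbourCount-sucP G (diff y x)
        (inter x y) (diff x y) (outside x y))
  neighbourSum-profile (true ∷ x) (false ∷ y) G =
    trans (cong (λ k → G (inter x y) (diff x y) + k) (neighbourSum-profile x y (λ p q → G p (suc q)))) (neighbourCount-sucB G (diff y x)
        (inter x y) (diff x y) (outside x y))
  neighbourSum-profile (false ∷ x) (true ∷ y) G =
    trans (cong (λ k → G (suc (inter x y)) (diff x y) + k) (neighbourSum-profile x y G)) (neighbourCount-sucA G (diff y x) (inter x y) (diff x y) (outside x y))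
  neighbourSum-profile (false ∷ x) (false ∷ y) G =
    trans (cong (λ k → G (inter x y) (suc (diff x y)) + k) (neighbourSum-profile x y G)) (neighbourCount-sucE G (diff y x) (inter x y) (diff x y) (outside x y))

  aboveProfile : ℕ → ℕ → ℕ → ℕ → ℚ
  aboveProfile j c p b = if p ℕ.+ b ≡ᵇ j then (if p ≡ᵇ c then 1ℚ else 0ℚ) else 0ℚ

  neighbourCount-aboveProfile : ∀ j c A P B E → P ≤ c → P ℕ.+ B ≡ suc j →
    neighbourCount (aboveProfile j c) A P B E ≡ ℕ→ℚ (suc j ∸ c) * (if P ≡ᵇ c then 1ℚ else 0ℚ)
  neighbourCount-aboveProfile j c A P B E Pc h = begin
      ℕ→ℚ A * aboveProfile j c (suc P) B + ℕ→ℚ P * aboveProfile j c (P ∸ 1) B + ℕ→ℚ B * aboveProfile j c P (B ∸ 1) + ℕ→ℚ E * aboveProfile j c P (suc B)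
        ≡⟨ cong₂ _+_ (cong₂ _+_ (cong₂ _+_ (cong (ℕ→ℚ A *_) g1) (t2 P Pc h)) refl) (cong (ℕ→ℚ E *_) g4) ⟩
      ℕ→ℚ A * 0ℚ + 0ℚ + ℕ→ℚ B * aboveProfile j c P (B ∸ 1) + ℕ→ℚ E * 0ℚ
        ≡⟨ solve 3 (λ a x e → a :* con 0ℚ :+ con 0ℚ :+ x :+ e :* con 0ℚ := x) refl (ℕ→ℚ A) (ℕ→ℚ B * aboveProfile j c P (B ∸ 1)) (ℕ→ℚ E) ⟩
      ℕ→ℚ B * aboveProfile j c P (B ∸ 1)
        ≡⟨ t3 B h ⟩
      ℕ→ℚ (suc j ∸ c) * (if P ≡ᵇ c then 1ℚ else 0ℚ) ∎
    where
    open ≡-Reasoning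
    g1 : aboveProfile j c (suc P) B ≡ 0ℚ
    g1 rewrite ≢⇒≡ᵇ-false (suc P ℕ.+ B) j (λ e → 2+n≢n j (trans (cong suc (sym h)) e)) = refl
    g4 : aboveProfile j c P (suc B) ≡ 0ℚ
    g4 rewrite ≢⇒≡ᵇ-false (P ℕ.+ suc B) j (λ e → 2+n≢n j (trans (cong suc (sym h)) (trans (sym (ℕP.+-suc P B)) e))) = refl
    t2 : ∀ P → P ≤ c → P ℕ.+ B ≡ suc j → ℕ→ℚ P * aboveProfile j c (P ∸ 1) B ≡ 0ℚ
    t2 zero _ _ = *-zeroˡ (aboveProfile j c 0 B)
    t2 (suc P') Pc' h' rewrite ≡⇒≡ᵇ-true (P' ℕ.+ B) j (ℕP.suc-injective h') | ≢⇒≡ᵇ-false P' c (λ e → ℕP.<-irrefl e Pc') = *-zeroʳ (ℕ→ℚ (suc P'))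
    t3 : ∀ B → P ℕ.+ B ≡ suc j → ℕ→ℚ B * aboveProfile j c P (B ∸ 1) ≡ ℕ→ℚ (suc j ∸ c) * (if P ≡ᵇ c then 1ℚ else 0ℚ)
    t3 zero h' = trans (*-zeroˡ (aboveProfile j c P 0)) (sym (rhs0 (P ℕ.≟ c)))
      where
      rhs0 : Dec (P ≡ c) → ℕ→ℚ (suc j ∸ c) * (if P ≡ᵇ c then 1ℚ else 0ℚ) ≡ 0ℚ
      rhs0 (yes e) rewrite ≡⇒≡ᵇ-true P c e = trans (cong (λ k → ℕ→ℚ k * 1ℚ)
          (trans (cong (_∸ c) (trans (sym h') (ℕP.+-identityʳ P))) (trans (cong (_∸ c) e) (ℕP.n∸n≡0 c)))) (*-zeroˡ 1ℚ)
      rhs0 (no ne) rewrite ≢⇒≡ᵇ-false P c ne = *-zeroʳ (ℕ→ℚ (suc j ∸ c))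
    t3 (suc B') h' rewrite ≡⇒≡ᵇ-true (P ℕ.+ B') j (ℕP.suc-injective (trans (sym (ℕP.+-suc P B')) h')) with P ℕ.≟ c
    ... | yes e rewrite ≡⇒≡ᵇ-true P c e = cong (λ k → ℕ→ℚ k * 1ℚ) (sym
        (trans (cong (_∸ c) (sym h')) (trans (cong (λ p → (p ℕ.+ suc B') ∸ c) e) (ℕP.m+n∸m≡n c (suc B')))))
    ... | no ne rewrite ≢⇒≡ᵇ-false P c ne = trans (*-zeroʳ (ℕ→ℚ (suc B'))) (sym (*-zeroʳ (ℕ→ℚ (suc j ∸ c))))

  -- Möbius inversion on subsets

  möbius : ∀ {m} → (Subset m → ℚ) → Subset m → ℚ
  möbius {zero} H [] = H []
  möbius {suc m} H (false ∷ z) = möbius (λ s → H (false ∷ s)) z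
  möbius {suc m} H (true ∷ z) = möbius (λ s → H (true ∷ s)) z - möbius (λ s → H (false ∷ s)) z

  sum-möbius : ∀ {m} (H : Subset m → ℚ) s → sumPts m (λ z → if subsetᵇ z s then möbius H z else 0ℚ) ≡ H s
  sum-möbius {zero} H [] = +-identityʳ (H [])
  sum-möbius {suc m} H (false ∷ s) = trans (sumPts-suc m _) (trans (cong₂ _+_ (sum-möbius (λ s → H (false ∷ s)) s) (sumOver-0 (allPts m)))
      (+-identityʳ (H (false ∷ s))))
  sum-möbius {suc m} H (true ∷ s) = trans (sumPts-suc m _) (trans (cong₂ _+_ (sum-möbius H0 s)
       (trans (sumOver-cong (allPts m) (λ z → if-minus (subsetᵇ z s) (möbius H1 z) (möbius H0 z)))
           (trans (sumOver-minus (allPts m) _ _) (cong₂ _-_ (sum-möbius H1 s) (sum-möbius H0 s)))))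
     (solve 2 (λ a b → a :+ (b :- a) := b) refl (H (false ∷ s)) (H (true ∷ s))))
    where
    H0 = λ s → H (false ∷ s)
    H1 = λ s → H (true ∷ s)

  count-ℕ : ∀ {m} (b : Subset m → Bool) → ∃ λ k → sumPts m (λ x → if b x then 1ℚ else 0ℚ) ≡ ℕ→ℚ k
  count-ℕ {zero} b with b []
  ... | true = 1 , +-identityʳ 1ℚ
  ... | false = 0 , refl
  count-ℕ {suc m} b with count-ℕ (λ x → b (false ∷ x)) | count-ℕ (λ x → b (true ∷ x))
  ... | k1 , e1 | k2 , e2 = k1 ℕ.+ k2 , trans (sumPts-suc m _) (trans (cong₂ _+_ e1 e2) (sym (ℕ→ℚ-+ k1 k2)))

  count-pos : ∀ {m} (b : Subset m → Bool) x → b x ≡ true → ∃ λ k → sumPts m (λ x → if b x then 1ℚ else 0ℚ) ≡ ℕ→ℚ (suc k)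
  count-pos {zero} b [] e rewrite e = 0 , +-identityʳ 1ℚ
  count-pos {suc m} b (false ∷ x) e with count-pos (λ x → b (false ∷ x)) x e | count-ℕ (λ x → b (true ∷ x))
  ... | k1 , e1 | k2 , e2 = k1 ℕ.+ k2 , trans (sumPts-suc m _) (trans (cong₂ _+_ e1 e2) (sym (ℕ→ℚ-+ (suc k1) k2)))
  count-pos {suc m} b (true ∷ x) e with count-ℕ (λ x → b (false ∷ x)) | count-pos (λ x → b (true ∷ x)) x e
  ... | k1 , e1 | k2 , e2 = k2 ℕ.+ k1 , trans (sumPts-suc m _) (trans (cong₂ _+_ e1 e2) (trans (+-comm (ℕ→ℚ k1) (ℕ→ℚ (suc k2))) (sym (ℕ→ℚ-+ (suc k2) k1))))

  -- The profile ψ and the adjacency relation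

  ψ : ℕ → ℕ → ℕ → ℚ
  ψ s m zero = 1ℚ
  ψ s m (suc a) = ψ s m a * (- ℕ→ℚ (s ℕ.+ suc a)) * frac 1 (m ∸ a)

  ψ-transfer : ∀ s M a → a ≤ M → ψ (suc s) M a * (ℕ→ℚ (suc s) * ℕ→ℚ (suc M ∸ a)) ≡ ψ s (suc M) a * (ℕ→ℚ (s ℕ.+ suc a) * ℕ→ℚ (suc M))
  ψ-transfer s M zero _ = cong (λ k → 1ℚ * (ℕ→ℚ k * ℕ→ℚ (suc M))) (ℕP.+-comm 1 s)
  ψ-transfer s M (suc a) h = begin
      (X * (- c2) * iv) * (u * v) ≡⟨ solve 5 (λ X c2 iv u v → (X :* (:- c2) :* iv) :* (u :* v) := (:- c2) :* (X :* u) :* (v :* iv)) refl X c2 iv u v ⟩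
      (- c2) * (X * u) * (v * iv) ≡⟨ cong (λ k → (- c2) * (X * u) * k) (trans (ℕ→ℚ-*-frac1 (M ∸ a) (ℕP.m<n⇒0<n∸m h))
          (sym (ℕ→ℚ-*-frac1 (suc M ∸ a) (ℕP.m<n⇒0<n∸m (ℕP.m≤n⇒m≤1+n h))))) ⟩
      (- c2) * (X * u) * (w * iw) ≡⟨ solve 5 (λ c2 X u w iw → (:- c2) :* (X :* u) :* (w :* iw) := (:- c2) :* (X :* (u :* w)) :* iw) refl c2 X u w iw ⟩
      (- c2) * (X * (u * w)) * iw ≡⟨ cong (λ k → (- c2) * k * iw) (ψ-transfer s M a (ℕP.≤-trans (ℕP.n≤1+n a) h)) ⟩
      (- c2) * (Y * (c1 * mm)) * iw ≡⟨ solve 5 (λ c2 Y c1 mm iw → (:- c2) :* (Y :* (c1 :* mm)) :* iw := (Y :* (:- c1) :* iw) :* (c2 :* mm)) refl c2 Y c1 mm iw ⟩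
      (Y * (- c1) * iw) * (c2 * mm) ≡⟨ cong (λ k → (Y * (- c1) * iw) * (ℕ→ℚ k * mm)) (sym (ℕP.+-suc s (suc a))) ⟩
      (Y * (- c1) * iw) * (ℕ→ℚ (s ℕ.+ suc (suc a)) * mm) ∎
    where
    open ≡-Reasoning
    X = ψ (suc s) M a ; Y = ψ s (suc M) a
    c2 = ℕ→ℚ (suc s ℕ.+ suc a) ; c1 = ℕ→ℚ (s ℕ.+ suc a)
    iv = frac 1 (M ∸ a) ; v = ℕ→ℚ (M ∸ a) ; u = ℕ→ℚ (suc s)
    w = ℕ→ℚ (suc M ∸ a) ; iw = frac 1 (suc M ∸ a) ; mm = ℕ→ℚ (suc M)

  ψ-up-step : ∀ s M t a → a ≤ t → t ≤ M →
    ℕ→ℚ (t ∸ a) * ψ s (suc M) (suc a) + ℕ→ℚ (s ℕ.+ suc a) * ψ s (suc M) a ≡ frac (suc s ℕ.* (suc M ∸ t)) (suc M) * ψ (suc s) M a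
  ψ-up-step s M t a a≤t t≤M = *-cancelʳ-≢0 (ta * (Y * (- c1) * iw) + c1 * Y) (fr * X) K Knz (begin
      (ta * (Y * (- c1) * iw) + c1 * Y) * (mm * (u * w))
        ≡⟨ solve 7 (λ ta Y c1 iw mm u w → (ta :* (Y :* (:- c1) :* iw) :+ c1 :* Y) :* (mm :* (u :* w)) := c1 :* Y :* mm :* u :*
            (w :- ta :* (w :* iw))) refl ta Y c1 iw mm u w ⟩
      c1 * Y * mm * u * (w - ta * (w * iw)) ≡⟨ cong (λ k → c1 * Y * mm * u * (w - ta * k)) (ℕ→ℚ-*-frac1 (suc M ∸ a) (ℕP.m<n⇒0<n∸m (s≤s (ℕP.≤-trans a≤t t≤M)))) ⟩
      c1 * Y * mm * u * (w - ta * 1ℚ) ≡⟨ cong (λ k → c1 * Y * mm * u * k) wta ⟩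
      c1 * Y * mm * u * Zq ≡⟨ solve 5 (λ c1 Y mm u Zq → c1 :* Y :* mm :* u :* Zq := (u :* Zq) :* (Y :* (c1 :* mm))) refl c1 Y mm u Zq ⟩
      (u * Zq) * (Y * (c1 * mm)) ≡⟨ cong₂ _*_ (trans (sym (ℕ→ℚ-* (suc s) (suc M ∸ t)))
          (sym (frac-*-denominator (suc s ℕ.* (suc M ∸ t)) M))) (sym (ψ-transfer s M a (ℕP.≤-trans a≤t t≤M))) ⟩
      (fr * mm) * (X * (u * w)) ≡⟨ solve 5 (λ fr mm X u w → (fr :* mm) :* (X :* (u :* w)) := fr :* X :* (mm :* (u :* w))) refl fr mm X u w ⟩
      fr * X * (mm * (u * w)) ∎)
    where
    open ≡-Reasoning
    X = ψ (suc s) M a ; Y = ψ s (suc M) a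
    c1 = ℕ→ℚ (s ℕ.+ suc a) ; ta = ℕ→ℚ (t ∸ a)
    u = ℕ→ℚ (suc s) ; w = ℕ→ℚ (suc M ∸ a) ; iw = frac 1 (suc M ∸ a) ; mm = ℕ→ℚ (suc M)
    Zq = ℕ→ℚ (suc M ∸ t) ; fr = frac (suc s ℕ.* (suc M ∸ t)) (suc M)
    K = mm * (u * w)
    a≤sM : a ≤ suc M
    a≤sM = ℕP.≤-trans a≤t (ℕP.m≤n⇒m≤1+n t≤M)
    Knz : K ≢ 0ℚ
    Knz = *-≢0 mm (u * w) (ℕ→ℚ-suc≢0 M) (*-≢0 u w (ℕ→ℚ-suc≢0 s) (ℕ→ℚ-pos≢0 _ (ℕP.m<n⇒0<n∸m (s≤s (ℕP.≤-trans a≤t t≤M)))))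
    wta : w - ta * 1ℚ ≡ Zq
    wta = begin
      w - ta * 1ℚ ≡⟨ cong₂ (λ p q → p - q * 1ℚ) (ℕ→ℚ-∸ (suc M) a a≤sM) (ℕ→ℚ-∸ t a a≤t) ⟩
      (mm - ℕ→ℚ a) - (ℕ→ℚ t - ℕ→ℚ a) * 1ℚ ≡⟨ solve 3 (λ mm a t → (mm :- a) :- (t :- a) :* con 1ℚ := mm :- t) refl mm (ℕ→ℚ a) (ℕ→ℚ t) ⟩
      mm - ℕ→ℚ t ≡⟨ sym (ℕ→ℚ-∸ (suc M) t (ℕP.m≤n⇒m≤1+n t≤M)) ⟩
      Zq ∎

  ψ-three-term : ∀ s m a → suc a ≤ m → ℕ→ℚ (suc a) * ψ s m a + ℕ→ℚ (m ∸ a) * ψ s m (suc a) ≡ - (ℕ→ℚ s * ψ s m a)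
  ψ-three-term s m a h = begin
      A1 * Y + v * (Y * (- c1) * iv) ≡⟨ solve 5 (λ A1 Y v c1 iv → A1 :* Y :+ v :* (Y :* (:- c1) :* iv) := A1 :* Y :- c1 :* Y :* (v :* iv)) refl A1 Y v c1 iv ⟩
      A1 * Y - c1 * Y * (v * iv) ≡⟨ cong (λ k → A1 * Y - c1 * Y * k) (ℕ→ℚ-*-frac1 (m ∸ a) (ℕP.m<n⇒0<n∸m h)) ⟩
      A1 * Y - c1 * Y * 1ℚ ≡⟨ cong (λ k → A1 * Y - k * Y * 1ℚ) (trans (cong ℕ→ℚ (ℕP.+-comm s (suc a))) (ℕ→ℚ-+ (suc a) s)) ⟩
      A1 * Y - (A1 + ℕ→ℚ s) * Y * 1ℚ ≡⟨ solve 3 (λ A1 Y s → A1 :* Y :- (A1 :+ s) :* Y :* con 1ℚ := :- (s :* Y)) refl A1 Y (ℕ→ℚ s) ⟩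
      - (ℕ→ℚ s * Y) ∎
    where
    open ≡-Reasoning
    Y = ψ s m a ; A1 = ℕ→ℚ (suc a) ; v = ℕ→ℚ (m ∸ a) ; iv = frac 1 (m ∸ a) ; c1 = ℕ→ℚ (s ℕ.+ suc a)

  ψ-down-step : ∀ s m a → a ≤ m → - (ℕ→ℚ (suc s) * ψ (suc s) m a) ≡ ℕ→ℚ (suc m) * ψ s (suc m) (suc a)
  ψ-down-step s m a h = sym (begin
      mm * (Y * (- c1) * iw) ≡⟨ solve 4 (λ mm Y c1 iw → mm :* (Y :* (:- c1) :* iw) := :- ((Y :* (c1 :* mm)) :* iw)) refl mm Y c1 iw ⟩
      - ((Y * (c1 * mm)) * iw) ≡⟨ cong (λ k → - (k * iw)) (sym (ψ-transfer s m a h)) ⟩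
      - ((X * (u * w)) * iw) ≡⟨ solve 4 (λ X u w iw → :- ((X :* (u :* w)) :* iw) := :- (u :* X) :* (w :* iw)) refl X u w iw ⟩
      - (u * X) * (w * iw) ≡⟨ cong (λ k → - (u * X) * k) (ℕ→ℚ-*-frac1 (suc m ∸ a) (ℕP.m<n⇒0<n∸m (s≤s h))) ⟩
      - (u * X) * 1ℚ ≡⟨ *-identityʳ (- (u * X)) ⟩
      - (u * X) ∎)
    where
    open ≡-Reasoning
    X = ψ (suc s) m a ; Y = ψ s (suc m) a ; u = ℕ→ℚ (suc s) ; mm = ℕ→ℚ (suc m)
    w = ℕ→ℚ (suc m ∸ a) ; iw = frac 1 (suc m ∸ a) ; c1 = ℕ→ℚ (s ℕ.+ suc a)

  -- profile n t j p b is f_{y,j}(x) for ∣ y ∣ = t, ∣ x ∩ y ∣ = p and ∣ x ∖ y ∣ = b; prevProfile and nextProfile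
  -- are the neighbouring levels with the conventions f_{y,t-1} = f_{y,r+1} = 0.
  profile : ℕ → ℕ → ℕ → ℕ → ℕ → ℚ
  profile n t j p b = if p ℕ.+ b ≡ᵇ j then ψ (j ∸ t) (n ∸ j) (t ∸ p) else 0ℚ

  profile-on : ∀ n t j p b → p ℕ.+ b ≡ j → profile n t j p b ≡ ψ (j ∸ t) (n ∸ j) (t ∸ p)
  profile-on n t j p b e rewrite ≡⇒≡ᵇ-true _ _ e = refl

  profile-off : ∀ n t j p b → p ℕ.+ b ≢ j → profile n t j p b ≡ 0ℚ
  profile-off n t j p b e rewrite ≢⇒≡ᵇ-false _ _ e = refl

  dropShared-term-off : ∀ n t j P B → P ℕ.+ B ≢ suc j → ℕ→ℚ P * profile n t j (P ∸ 1) B ≡ 0ℚ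
  dropShared-term-off n t j zero B _ = *-zeroˡ (profile n t j 0 B)
  dropShared-term-off n t j (suc P) B ne = trans (cong (ℕ→ℚ (suc P) *_) (profile-off n t j P B (λ e → ne (cong suc e)))) (*-zeroʳ (ℕ→ℚ (suc P)))

  dropOwn-term-off : ∀ n t j P B → P ℕ.+ B ≢ suc j → ℕ→ℚ B * profile n t j P (B ∸ 1) ≡ 0ℚ
  dropOwn-term-off n t j P zero _ = *-zeroˡ (profile n t j P 0)
  dropOwn-term-off n t j P (suc B) ne = trans (cong (ℕ→ℚ (suc B) *_) (profile-off n t j P B
      (λ e → ne (trans (ℕP.+-suc P B) (cong suc e))))) (*-zeroʳ (ℕ→ℚ (suc B)))

  prevProfile : ℕ → ℕ → ℕ → ℕ → ℕ → ℚ
  prevProfile n t i P B = if t <ᵇ i then profile n t (i ∸ 1) P B else 0ℚ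

  nextProfile : ℕ → ℕ → ℕ → ℕ → ℕ → ℕ → ℚ
  nextProfile n r t i P B = if i <ᵇ r then profile n t (suc i) P B else 0ℚ

  prevProfile-off : ∀ n t i P B → suc (P ℕ.+ B) ≢ i → prevProfile n t i P B ≡ 0ℚ
  prevProfile-off n t zero P B ne = refl
  prevProfile-off n t (suc i) P B ne with t <ᵇ suc i
  ... | false = refl
  ... | true = profile-off n t i P B (λ e → ne (cong suc e))

  nextProfile-off : ∀ n r t i P B → P ℕ.+ B ≢ suc i → nextProfile n r t i P B ≡ 0ℚ
  nextProfile-off n r t i P B ne with i <ᵇ r
  ... | false = refl
  ... | true = profile-off n t (suc i) P B ne

  nextProfile-on : ∀ n r t i P B → i < r → nextProfile n r t i P B ≡ profile n t (suc i) P B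
  nextProfile-on n r t i P B h rewrite <⇒<ᵇ-true h = refl

  prevProfile-on : ∀ n t i P B → t < i → prevProfile n t i P B ≡ profile n t (i ∸ 1) P B
  prevProfile-on n t i P B h rewrite <⇒<ᵇ-true h = refl

  prevProfile-bottom : ∀ n t i P B → ¬ t < i → prevProfile n t i P B ≡ 0ℚ
  prevProfile-bottom n t i P B h rewrite ≮⇒<ᵇ-false t i h = refl

  dropOwn-term-on : ∀ n t i P B B' → B ≡ suc B' → P ℕ.+ B' ≡ i → ℕ→ℚ B * profile n t i P (B ∸ 1) ≡ ℕ→ℚ B * ψ (i ∸ t) (n ∸ i) (t ∸ P)
  dropOwn-term-on n t i P .(suc B') B' refl e = cong (ℕ→ℚ (suc B') *_) (profile-on n t i P B' e)

  γ≡frac : ∀ n t i M → n ∸ i ≡ suc M → γ n t i ≡ frac (suc (i ∸ t) ℕ.* (suc M ∸ t)) (suc M)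
  γ≡frac n t i M e = cong₂ (λ a b → frac (suc (i ∸ t) ℕ.* a) b)
    (trans (ℕP.∸-+-assoc n t i) (trans (cong (n ∸_) (ℕP.+-comm t i)) (trans (sym (ℕP.∸-+-assoc n i t)) (cong (_∸ t) e)))) e

  dropShared-term-on : ∀ n t i M A P B → P ℕ.+ B ≡ suc i → t ≡ P ℕ.+ A → n ∸ i ≡ suc M →
    ℕ→ℚ P * profile n t i (P ∸ 1) B ≡ ℕ→ℚ (t ∸ A) * ψ (i ∸ t) (suc M) (suc A)
  dropShared-term-on n .A i M A zero B h refl f1 = trans (*-zeroˡ (profile n A i 0 B)) (sym
      (trans (cong (λ k → ℕ→ℚ k * ψ (i ∸ A) (suc M) (suc A)) (ℕP.n∸n≡0 A)) (*-zeroˡ (ψ (i ∸ A) (suc M) (suc A)))))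
  dropShared-term-on n t i M A (suc P') B h refl f1 = trans (cong (ℕ→ℚ (suc P') *_) (profile-on n t i P' B (ℕP.suc-injective h)))
     (trans (cong₂ (λ a b → ℕ→ℚ a * ψ (i ∸ t) b (t ∸ P')) (sym (ℕP.m+n∸n≡m (suc P') A)) f1)
            (cong (λ c → ℕ→ℚ (t ∸ A) * ψ (i ∸ t) (suc M) c) (trans (cong (_∸ P') (sym (ℕP.+-suc P' A))) (ℕP.m+n∸m≡n P' (suc A)))))

  neighbourCount-level-above-ψ : ∀ n t i M P B A E → P ℕ.+ B ≡ suc i → t ≡ P ℕ.+ A → t ≤ i → n ∸ i ≡ suc M →
    neighbourCount (profile n t i) A P B E ≡ ℕ→ℚ (t ∸ A) * ψ (i ∸ t) (suc M) (suc A) + ℕ→ℚ (i ∸ t ℕ.+ suc A) * ψ (i ∸ t) (suc M) A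
  neighbourCount-level-above-ψ n t i M P B A E h tA ti f1 = begin
      ℕ→ℚ A * profile n t i (suc P) B + ℕ→ℚ P * profile n t i (P ∸ 1) B + ℕ→ℚ B * profile n t i P (B ∸ 1) + ℕ→ℚ E * profile n t i P (suc B)
        ≡⟨ cong₂ _+_ (cong₂ _+_ (cong₂ _+_ (cong (ℕ→ℚ A *_) add-term) shared-term) own-term) (cong (ℕ→ℚ E *_) outside-term) ⟩
      ℕ→ℚ A * 0ℚ + ℕ→ℚ (t ∸ A) * ψ s (suc M) (suc A) + ℕ→ℚ (s ℕ.+ suc A) * ψ s (suc M) A + ℕ→ℚ E * 0ℚ
        ≡⟨ solve 6 (λ a x y z w e → a :* con 0ℚ :+ x :* y :+ z :* w :+ e :* con 0ℚ := x :* y :+ z :* w) refl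
            (ℕ→ℚ A) (ℕ→ℚ (t ∸ A)) (ψ s (suc M) (suc A)) (ℕ→ℚ (s ℕ.+ suc A)) (ψ s (suc M) A) (ℕ→ℚ E) ⟩
      ℕ→ℚ (t ∸ A) * ψ s (suc M) (suc A) + ℕ→ℚ (s ℕ.+ suc A) * ψ s (suc M) A ∎
    where
    open ≡-Reasoning
    s = i ∸ t
    add-term : profile n t i (suc P) B ≡ 0ℚ
    add-term = profile-off n t i (suc P) B (λ e → 2+n≢n i (trans (cong suc (sym h)) e))
    outside-term : profile n t i P (suc B) ≡ 0ℚ
    outside-term = profile-off n t i P (suc B) (λ e → 2+n≢n i (trans (cong suc (sym h)) (trans (sym (ℕP.+-suc P B)) e)))
    shared-term : ℕ→ℚ P * profile n t i (P ∸ 1) B ≡ ℕ→ℚ (t ∸ A) * ψ s (suc M) (suc A)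
    shared-term = dropShared-term-on n t i M A P B h tA f1
    eB : B ≡ suc (s ℕ.+ A)
    eB = ℕP.+-cancelˡ-≡ P B (suc (s ℕ.+ A)) (trans h (trans (cong suc (trans (sym (ℕP.m∸n+n≡m ti)) (trans (cong (s ℕ.+_) tA)
          (trans (sym (ℕP.+-assoc s P A)) (trans (cong (ℕ._+ A) (ℕP.+-comm s P)) (ℕP.+-assoc P s A)))))) (sym (ℕP.+-suc P (s ℕ.+ A)))))
    own-term : ℕ→ℚ B * profile n t i P (B ∸ 1) ≡ ℕ→ℚ (s ℕ.+ suc A) * ψ s (suc M) A
    own-term = trans (dropOwn-term-on n t i P B (s ℕ.+ A) eB (ℕP.+-cancelˡ-≡ 1 _ _ (trans (sym (ℕP.+-suc P (s ℕ.+ A))) (trans (cong (P ℕ.+_) (sym eB)) h))))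
      (trans (cong₂ (λ a b → ℕ→ℚ a * ψ s b (t ∸ P)) (trans eB (sym (ℕP.+-suc s A))) f1)
             (cong (λ c → ℕ→ℚ (s ℕ.+ suc A) * ψ s (suc M) c) (trans (cong (_∸ P) tA) (ℕP.m+n∸m≡n P A))))

  neighbourCount-level-above : ∀ n r t i P B A E → P ℕ.+ B ≡ suc i → t ≡ P ℕ.+ A → t ≤ i → P ℕ.+ B ≤ r → r ℕ.+ r ≤ n →
    neighbourCount (profile n t i) A P B E ≡ β n i * prevProfile n t i P B + γ n t i * nextProfile n r t i P B
  neighbourCount-level-above n r t i P B A E h tA ti xr r+r≤n = begin
      neighbourCount (profile n t i) A P B E
        ≡⟨ neighbourCount-level-above-ψ n t i M P B A E h tA ti f1 ⟩
      ℕ→ℚ (t ∸ A) * ψ s (suc M) (suc A) + ℕ→ℚ (s ℕ.+ suc A) * ψ s (suc M) A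
        ≡⟨ ψ-up-step s M t A At tM ⟩
      frac (suc s ℕ.* (suc M ∸ t)) (suc M) * ψ (suc s) M A
        ≡⟨ solve 3 (λ b f p → f :* p := b :* con 0ℚ :+ f :* p) refl (β n i) (frac (suc s ℕ.* (suc M ∸ t)) (suc M)) (ψ (suc s) M A) ⟩
      β n i * 0ℚ + frac (suc s ℕ.* (suc M ∸ t)) (suc M) * ψ (suc s) M A
        ≡⟨ sym (cong₂ (λ p q → β n i * p + q) (prevProfile-off n t i P B (λ e → 2+n≢n i (trans (cong suc (sym h)) e)))
                (cong₂ _*_ (γ≡frac n t i M f1) (trans (nextProfile-on n r t i P B si≤r) nv))) ⟩
      β n i * prevProfile n t i P B + γ n t i * nextProfile n r t i P B ∎
    where
    open ≡-Reasoning
    s = i ∸ t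
    M = n ∸ suc i
    si≤r : suc i ≤ r
    si≤r = subst (_≤ r) h xr
    f1 : n ∸ i ≡ suc M
    f1 = ℕP.+-∸-assoc 1 (ℕP.≤-trans si≤r (ℕP.≤-trans (ℕP.m≤m+n r r) r+r≤n))
    t≤r : t ≤ r
    t≤r = ℕP.≤-trans ti (ℕP.≤-trans (ℕP.n≤1+n i) si≤r)
    tM : t ≤ M
    tM = ℕP.m+n≤o⇒m≤o∸n t (ℕP.≤-trans (ℕP.+-mono-≤ t≤r si≤r) r+r≤n)
    At : A ≤ t
    At = subst (A ≤_) (sym tA) (ℕP.m≤n+m A P)
    nv : profile n t (suc i) P B ≡ ψ (suc s) M A
    nv = trans (profile-on n t (suc i) P B h) (cong₂ (λ a c → ψ a M c) (ℕP.+-∸-assoc 1 ti) (trans (cong (_∸ P) tA) (ℕP.m+n∸m≡n P A)))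

  outside≡n∸i+1 : ∀ n q E → n ≡ q ℕ.+ 0 ℕ.+ E → suc q ≤ n → E ≡ suc (n ∸ suc q)
  outside≡n∸i+1 n q zero nE i≤n = ⊥-elim (ℕP.<-irrefl refl (ℕP.≤-trans i≤n (ℕP.≤-reflexive (trans nE (trans (ℕP.+-identityʳ _) (ℕP.+-identityʳ _))))))
  outside≡n∸i+1 n q (suc E') nE i≤n = cong suc (sym (trans (cong (_∸ suc q)
      (trans nE (trans (cong (ℕ._+ suc E') (ℕP.+-identityʳ q)) (ℕP.+-suc q E')))) (ℕP.m+n∸m≡n (suc q) E')))

  below-terms-y⊆x : ∀ n t i P B E → suc (P ℕ.+ B) ≡ i → t ≡ P → n ≡ P ℕ.+ B ℕ.+ 0 ℕ.+ E → i ≤ n →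
    ℕ→ℚ 0 * ψ (i ∸ t) (n ∸ i) (t ∸ suc P) + ℕ→ℚ E * ψ (i ∸ t) (n ∸ i) (t ∸ P) ≡ β n i * prevProfile n t i P B
  below-terms-y⊆x n .P .(suc (P ℕ.+ B)) P B E refl refl nE i≤n = begin
      ℕ→ℚ 0 * ψ s m (P ∸ suc P) + ℕ→ℚ E * ψ s m (P ∸ P) ≡⟨ cong (λ k → ℕ→ℚ 0 * ψ s m (P ∸ suc P) + ℕ→ℚ E * ψ s m k) (ℕP.n∸n≡0 P) ⟩
      ℕ→ℚ 0 * ψ s m (P ∸ suc P) + ℕ→ℚ E * 1ℚ ≡⟨ solve 2 (λ x e → con 0ℚ :* x :+ e :* con 1ℚ := e :* con 1ℚ) refl (ψ s m (P ∸ suc P)) (ℕ→ℚ E) ⟩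
      ℕ→ℚ E * 1ℚ ≡⟨ cong₂ _*_ (cong ℕ→ℚ eE) (sym pv) ⟩
      β n i * prevProfile n P i P B ∎
    where
    open ≡-Reasoning
    i = suc (P ℕ.+ B)
    s = i ∸ P ; m = n ∸ i
    q = P ℕ.+ B
    eE : E ≡ suc (n ∸ i)
    eE = outside≡n∸i+1 n q E nE i≤n
    pv : prevProfile n P i P B ≡ 1ℚ
    pv = trans (prevProfile-on n P i P B (s≤s (ℕP.m≤m+n P B))) (trans (profile-on n P (i ∸ 1) P B refl) (cong (ψ _ _) (ℕP.n∸n≡0 P)))

  β-prevProfile : ∀ n t i P B a → suc (P ℕ.+ B) ≡ i → t ∸ P ≡ suc a → i ≤ n → a ≤ n ∸ i →
    - (ℕ→ℚ (i ∸ t) * ψ (i ∸ t) (n ∸ i) a) ≡ β n i * prevProfile n t i P B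
  β-prevProfile n t i P B a h e2 i≤n a≤m with t ℕP.<? i
  ... | no ¬t<i = trans (cong (λ k → - (ℕ→ℚ k * ψ (i ∸ t) (n ∸ i) a)) (ℕP.m≤n⇒m∸n≡0 (ℕP.≮⇒≥ ¬t<i)))
        (trans (solve 2 (λ x b → :- (con 0ℚ :* x) := b :* con 0ℚ) refl (ψ (i ∸ t) (n ∸ i) a) (β n i))
               (cong (β n i *_) (sym (prevProfile-bottom n t i P B ¬t<i))))
  ... | yes t<i = begin
        - (ℕ→ℚ (i ∸ t) * ψ (i ∸ t) m a) ≡⟨ cong (λ k → - (ℕ→ℚ k * ψ k m a)) (ℕP.+-∸-assoc 1 t<i) ⟩
        - (ℕ→ℚ (suc s') * ψ (suc s') m a) ≡⟨ ψ-down-step s' m a a≤m ⟩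
        ℕ→ℚ (suc m) * ψ s' (suc m) (suc a) ≡⟨ cong (ℕ→ℚ (suc m) *_) (sym pv) ⟩
        β n i * prevProfile n t i P B ∎
    where
    open ≡-Reasoning
    m = n ∸ i
    s' = i ∸ suc t
    cong₃ : ∀ {a a' b b' c c'} → a ≡ a' → b ≡ b' → c ≡ c' → ψ a b c ≡ ψ a' b' c'
    cong₃ refl refl refl = refl
    pv : prevProfile n t i P B ≡ ψ s' (suc m) (suc a)
    pv = trans (prevProfile-on n t i P B t<i) (trans (profile-on n t (i ∸ 1) P B (cong (_∸ 1) h))
           (cong₃ (ℕP.∸-+-assoc i 1 t) (trans (cong (n ∸_) (cong (_∸ 1) (sym h)))
             (trans (ℕP.+-∸-assoc 1 (subst (_≤ n) (sym h) i≤n)) (cong (λ k → suc (n ∸ k)) h))) e2))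

  below-terms-y⊈x : ∀ n t i P B a E → suc (P ℕ.+ B) ≡ i → t ≡ P ℕ.+ suc a → n ≡ P ℕ.+ B ℕ.+ suc a ℕ.+ E → suc a ℕ.+ i ≤ n →
    ℕ→ℚ (suc a) * ψ (i ∸ t) (n ∸ i) (t ∸ suc P) + ℕ→ℚ E * ψ (i ∸ t) (n ∸ i) (t ∸ P) ≡ β n i * prevProfile n t i P B
  below-terms-y⊈x n t i P B a E h tA nE hn = begin
      ℕ→ℚ (suc a) * ψ s m (t ∸ suc P) + ℕ→ℚ E * ψ s m (t ∸ P)
        ≡⟨ cong₂ (λ u v → ℕ→ℚ (suc a) * ψ s m u + ℕ→ℚ v * ψ s m (t ∸ P)) e1 eE ⟩
      ℕ→ℚ (suc a) * ψ s m a + ℕ→ℚ (m ∸ a) * ψ s m (t ∸ P)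
        ≡⟨ cong (λ u → ℕ→ℚ (suc a) * ψ s m a + ℕ→ℚ (m ∸ a) * ψ s m u) e2 ⟩
      ℕ→ℚ (suc a) * ψ s m a + ℕ→ℚ (m ∸ a) * ψ s m (suc a)
        ≡⟨ ψ-three-term s m a am ⟩
      - (ℕ→ℚ s * ψ s m a)
        ≡⟨ β-prevProfile n t i P B a h e2 (ℕP.≤-trans (ℕP.m≤n+m i (suc a)) hn) (ℕP.≤-trans (ℕP.n≤1+n a) am) ⟩
      β n i * prevProfile n t i P B ∎
    where
    open ≡-Reasoning
    s = i ∸ t ; m = n ∸ i ; q = P ℕ.+ B
    e1 : t ∸ suc P ≡ a
    e1 = trans (cong (_∸ suc P) (trans tA (ℕP.+-suc P a))) (ℕP.m+n∸m≡n (suc P) a)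
    e2 : t ∸ P ≡ suc a
    e2 = trans (cong (_∸ P) tA) (ℕP.m+n∸m≡n P (suc a))
    mE : m ≡ a ℕ.+ E
    mE = trans (cong₂ _∸_ nE (sym h)) (trans (cong (_∸ suc q) (trans (ℕP.+-assoc q (suc a) E) (ℕP.+-suc q (a ℕ.+ E))))
           (ℕP.m+n∸m≡n (suc q) (a ℕ.+ E)))
    eE : E ≡ m ∸ a
    eE = sym (trans (cong (_∸ a) mE) (ℕP.m+n∸m≡n a E))
    am : suc a ≤ m
    am = ℕP.m+n≤o⇒m≤o∸n (suc a) hn

  below-terms : ∀ n t i P B A E → suc (P ℕ.+ B) ≡ i → t ≡ P ℕ.+ A → n ≡ P ℕ.+ B ℕ.+ A ℕ.+ E → A ℕ.+ i ≤ n →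
    ℕ→ℚ A * ψ (i ∸ t) (n ∸ i) (t ∸ suc P) + ℕ→ℚ E * ψ (i ∸ t) (n ∸ i) (t ∸ P) ≡ β n i * prevProfile n t i P B
  below-terms n t i P B zero E h tA nE hn = below-terms-y⊆x n t i P B E h (trans tA (ℕP.+-identityʳ P)) nE hn
  below-terms n t i P B (suc a) E h tA nE hn = below-terms-y⊈x n t i P B a E h tA nE hn

  neighbourCount-level-below : ∀ n r t i P B A E → suc (P ℕ.+ B) ≡ i → t ≡ P ℕ.+ A → n ≡ P ℕ.+ B ℕ.+ A ℕ.+ E → t ≤ i → i ≤ r → r ℕ.+ r ≤ n →
    neighbourCount (profile n t i) A P B E ≡ β n i * prevProfile n t i P B + γ n t i * nextProfile n r t i P B
  neighbourCount-level-below n r t i P B A E h tA nE ti ir r+r≤n = begin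
      ℕ→ℚ A * profile n t i (suc P) B + ℕ→ℚ P * profile n t i (P ∸ 1) B + ℕ→ℚ B * profile n t i P (B ∸ 1) + ℕ→ℚ E * profile n t i P (suc B)
        ≡⟨ cong₂ _+_ (cong₂ _+_ (cong₂ _+_ (cong (ℕ→ℚ A *_) (profile-on n t i (suc P) B h)) (dropShared-term-off n t i P B ne)) (dropOwn-term-off n t i P B ne))
             (cong (ℕ→ℚ E *_) (profile-on n t i P (suc B) (trans (ℕP.+-suc P B) h))) ⟩
      ℕ→ℚ A * ψ1 + 0ℚ + 0ℚ + ℕ→ℚ E * ψ4
        ≡⟨ solve 4 (λ a x e y → a :* x :+ con 0ℚ :+ con 0ℚ :+ e :* y := a :* x :+ e :* y) refl (ℕ→ℚ A) ψ1 (ℕ→ℚ E) ψ4 ⟩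
      ℕ→ℚ A * ψ1 + ℕ→ℚ E * ψ4
        ≡⟨ below-terms n t i P B A E h tA nE hn ⟩
      β n i * prevProfile n t i P B
        ≡⟨ solve 3 (λ x g y → x := x :+ g :* con 0ℚ) refl (β n i * prevProfile n t i P B) (γ n t i) (β n i) ⟩
      β n i * prevProfile n t i P B + γ n t i * 0ℚ
        ≡⟨ cong (λ k → β n i * prevProfile n t i P B + γ n t i * k) (sym (nextProfile-off n r t i P B ne)) ⟩
      β n i * prevProfile n t i P B + γ n t i * nextProfile n r t i P B ∎
    where
    open ≡-Reasoning
    ψ1 = ψ (i ∸ t) (n ∸ i) (t ∸ suc P)
    ψ4 = ψ (i ∸ t) (n ∸ i) (t ∸ P)
    ne : P ℕ.+ B ≢ suc i
    ne e = 2+n≢n i (trans (cong suc (sym e)) h)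
    A≤t : A ≤ t
    A≤t = subst (A ≤_) (sym tA) (ℕP.m≤n+m A P)
    hn : A ℕ.+ i ≤ n
    hn = ℕP.≤-trans (ℕP.+-mono-≤ (ℕP.≤-trans A≤t (ℕP.≤-trans ti ir)) ir) r+r≤n

  neighbourCount-level-far : ∀ n r t i P B A E → P ℕ.+ B ≢ suc i → suc (P ℕ.+ B) ≢ i →
    neighbourCount (profile n t i) A P B E ≡ β n i * prevProfile n t i P B + γ n t i * nextProfile n r t i P B
  neighbourCount-level-far n r t i P B A E h1 h2 = begin
      ℕ→ℚ A * profile n t i (suc P) B + ℕ→ℚ P * profile n t i (P ∸ 1) B + ℕ→ℚ B * profile n t i P (B ∸ 1) + ℕ→ℚ E * profile n t i P (suc B)
        ≡⟨ cong₂ _+_ (cong₂ _+_ (cong₂ _+_ (cong (ℕ→ℚ A *_) (profile-off n t i (suc P) B h2)) (dropShared-term-off n t i P B h1))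
            (dropOwn-term-off n t i P B h1))
             (cong (ℕ→ℚ E *_) (profile-off n t i P (suc B) (λ e → h2 (trans (sym (ℕP.+-suc P B)) e)))) ⟩
      ℕ→ℚ A * 0ℚ + 0ℚ + 0ℚ + ℕ→ℚ E * 0ℚ
        ≡⟨ solve 4 (λ a e b g → a :* con 0ℚ :+ con 0ℚ :+ con 0ℚ :+ e :* con 0ℚ := b :* con 0ℚ :+ g :* con 0ℚ) refl (ℕ→ℚ A) (ℕ→ℚ E) (β n i) (γ n t i) ⟩
      β n i * 0ℚ + γ n t i * 0ℚ
        ≡⟨ sym (cong₂ (λ u v → β n i * u + γ n t i * v) (prevProfile-off n t i P B h2) (nextProfile-off n r t i P B h1)) ⟩
      β n i * prevProfile n t i P B + γ n t i * nextProfile n r t i P B ∎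
    where open ≡-Reasoning

  neighbourCount-profile : ∀ n r t i P B A E → t ≡ P ℕ.+ A → n ≡ P ℕ.+ B ℕ.+ A ℕ.+ E → t ≤ i → i ≤ r → P ℕ.+ B ≤ r → r ℕ.+ r ≤ n →
    neighbourCount (profile n t i) A P B E ≡ β n i * prevProfile n t i P B + γ n t i * nextProfile n r t i P B
  neighbourCount-profile n r t i P B A E tA nE ti ir xr r+r≤n with P ℕ.+ B ℕP.≟ suc i | suc (P ℕ.+ B) ℕP.≟ i
  ... | yes h | _ = neighbourCount-level-above n r t i P B A E h tA ti xr r+r≤n
  ... | no _ | yes h = neighbourCount-level-below n r t i P B A E h tA nE ti ir r+r≤n
  ... | no h1 | no h2 = neighbourCount-level-far n r t i P B A E h1 h2

  lookup-map-applyUpTo : ∀ {A : Set} (g : ℕ → A) (h : ℕ → ℕ) N (k : Fin (length (map g (applyUpTo h N)))) → List.lookup (map g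
      (applyUpTo h N)) k ≡ g (h (toℕ k))
  lookup-map-applyUpTo g h (suc N) Fin.zero = refl
  lookup-map-applyUpTo g h (suc N) (Fin.suc k) = lookup-map-applyUpTo g (λ j → h (suc j)) N k

  -- Pairings with g_z on a slice

  module _ {n : ℕ} where

    adjCube : Fn n → Subset n → ℚ
    adjCube F w = sumPts n (λ x → if dist w x ≡ᵇ 1 then F x else 0ℚ)

    above : Subset n → Fn n
    above z x = if subsetᵇ z x then 1ℚ else 0ℚ

    massAbove : ℕ → Fn n → Subset n → ℚ
    massAbove i F z = sumPts n (λ x → if ∣ x ∣ ≡ᵇ i then F x * above z x else 0ℚ)

    aboveAt : ℕ → Subset n → Fn n
    aboveAt j z w = if ∣ w ∣ ≡ᵇ j then above z w else 0ℚ

    aboveAt-profile : ∀ j z w → aboveAt j z w ≡ aboveProfile j ∣ z ∣ (inter w z) (diff w z)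
    aboveAt-profile j z w rewrite sym (∣x∣≡inter+diff w z) | subsetᵇ≡inter≡ᵇ∣∣ z w = refl

    neighbourSum-aboveAt : ∀ j z x → ∣ x ∣ ≡ suc j → neighbourSum (aboveAt j z) x ≡ ℕ→ℚ (suc j ∸ ∣ z ∣) * above z x
    neighbourSum-aboveAt j z x e = trans (neighbourSum-cong _ _ (aboveAt-profile j z) x) (trans (neighbourSum-profile x z (aboveProfile j ∣ z ∣))
      (trans (neighbourCount-aboveProfile j ∣ z ∣ (diff z x) (inter x z) (diff x z) (outside x z) (inter≤∣∣ʳ x z) (trans (sym (∣x∣≡inter+diff x z)) e))
        (cong (λ b → ℕ→ℚ (suc j ∸ ∣ z ∣) * (if b then 1ℚ else 0ℚ)) (sym (subsetᵇ≡inter≡ᵇ∣∣ z x)))))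

    massAbove-adjCube : ∀ j (F : Fn n) z → (∀ x → ∣ x ∣ ≢ suc j → F x ≡ 0ℚ) →
       sumPts n (λ w → if ∣ w ∣ ≡ᵇ j then adjCube F w * above z w else 0ℚ) ≡ ℕ→ℚ (suc j ∸ ∣ z ∣) * massAbove (suc j) F z
    massAbove-adjCube j F z supp = begin
        sumPts n (λ w → if ∣ w ∣ ≡ᵇ j then adjCube F w * above z w else 0ℚ)
          ≡⟨ sumOver-cong (allPts n) unfold-adj ⟩
        sumPts n (λ w → sumPts n (λ x → if ∣ w ∣ ≡ᵇ j then (if dist w x ≡ᵇ 1 then F x else 0ℚ) * above z w else 0ℚ))
          ≡⟨ sumOver-comm (allPts n) (allPts n) _ ⟩
        sumPts n (λ x → sumPts n (λ w → if ∣ w ∣ ≡ᵇ j then (if dist w x ≡ᵇ 1 then F x else 0ℚ) * above z w else 0ℚ))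
          ≡⟨ sumOver-cong (allPts n) neighbour-form ⟩
        sumPts n (λ x → F x * neighbourSum (aboveAt j z) x)
          ≡⟨ sumOver-cong (allPts n) lower-count ⟩
        sumPts n (λ x → ℕ→ℚ (suc j ∸ ∣ z ∣) * (if ∣ x ∣ ≡ᵇ suc j then F x * above z x else 0ℚ))
          ≡⟨ sumOver-* (allPts n) (ℕ→ℚ (suc j ∸ ∣ z ∣)) (λ x → if ∣ x ∣ ≡ᵇ suc j then F x * above z x else 0ℚ) ⟩
        ℕ→ℚ (suc j ∸ ∣ z ∣) * massAbove (suc j) F z ∎
      where
      open ≡-Reasoning
      unfold-adj : ∀ w → (if ∣ w ∣ ≡ᵇ j then adjCube F w * above z w else 0ℚ) ≡ sumPts n (λ x → if ∣ w ∣ ≡ᵇ j then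
          (if dist w x ≡ᵇ 1 then F x else 0ℚ) * above z w else 0ℚ)
      unfold-adj w with ∣ w ∣ ≡ᵇ j
      ... | true = trans (*-comm (adjCube F w) (above z w)) (trans (sym (sumOver-* (allPts n) (above z w) _))
          (sumOver-cong (allPts n) (λ x → *-comm (above z w) _)))
      ... | false = sym (sumOver-0 (allPts n))
      flip-pair : ∀ x w → (if ∣ w ∣ ≡ᵇ j then (if dist w x ≡ᵇ 1 then F x else 0ℚ) * above z w else 0ℚ) ≡ F x * (if dist x w ≡ᵇ 1 then aboveAt j z w else 0ℚ)
      flip-pair x w rewrite dist-comm x w with ∣ w ∣ ≡ᵇ j | dist w x ≡ᵇ 1
      ... | true | true = refl
      ... | true | false = trans (*-zeroˡ (above z w)) (sym (*-zeroʳ (F x)))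
      ... | false | true = sym (*-zeroʳ (F x))
      ... | false | false = sym (*-zeroʳ (F x))
      neighbour-form : ∀ x → sumPts n (λ w → if ∣ w ∣ ≡ᵇ j then (if dist w x ≡ᵇ 1 then F x else 0ℚ) * above z w else 0ℚ) ≡ F x * neighbourSum (aboveAt j z) x
      neighbour-form x = trans (sumOver-cong (allPts n) (flip-pair x)) (trans (sumOver-* (allPts n) (F x) _) (cong (F x *_) (sumPts-dist≡1 x (aboveAt j z))))
      lower-count : ∀ x → F x * neighbourSum (aboveAt j z) x ≡ ℕ→ℚ (suc j ∸ ∣ z ∣) * (if ∣ x ∣ ≡ᵇ suc j then F x * above z x else 0ℚ)
      lower-count x with ∣ x ∣ ℕP.≟ suc j
      ... | yes e rewrite ≡⇒≡ᵇ-true _ _ e = trans (cong (F x *_) (neighbourSum-aboveAt j z x e))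
             (solve 3 (λ f k g → f :* (k :* g) := k :* (f :* g)) refl (F x) (ℕ→ℚ (suc j ∸ ∣ z ∣)) (above z x))
      ... | no ne rewrite ≢⇒≡ᵇ-false _ _ ne | supp x ne = trans (*-zeroˡ (neighbourSum (aboveAt j z) x)) (sym (*-zeroʳ (ℕ→ℚ (suc j ∸ ∣ z ∣))))

    gz≡above : ∀ i z x → gz i z x ≡ above z x
    gz≡above i z x = cong (λ b → if b then 1ℚ else 0ℚ) (does-⊆?≡subsetᵇ z x)

    subsetᵇ⇒⊆ : ∀ (z x : Subset n) → subsetᵇ z x ≡ true → z ⊆ x
    subsetᵇ⇒⊆ z x e with z ⊆? x | does-⊆?≡subsetᵇ z x
    ... | yes p | _ = p
    ... | no _ | e' with trans e' e
    ... | ()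

    gz∈U : ∀ i z k' → ∣ z ∣ ≤ k' → InU i k' (gz i z)
    gz∈U i z k' zk = (λ w → if dist z w ≡ᵇ 0 then 1ℚ else 0ℚ) , λ x xi →
       sym (trans (sumOver-cong (allPts n) (pt x)) (trans (sumPts-dist≡0 z (λ w → if ∣ w ∣ ≤ᵇ k' then gz i w x else 0ℚ))
         (cong (λ b → if b then gz i z x else 0ℚ) (Equivalence.to T-≡ (ℕP.≤⇒≤ᵇ zk)))))
      where
      pt : ∀ x w → (if ∣ w ∣ ≤ᵇ k' then (if dist z w ≡ᵇ 0 then 1ℚ else 0ℚ) * gz i w x else 0ℚ)
                 ≡ (if dist z w ≡ᵇ 0 then (if ∣ w ∣ ≤ᵇ k' then gz i w x else 0ℚ) else 0ℚ)
      pt x w with ∣ w ∣ ≤ᵇ k' | dist z w ≡ᵇ 0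
      ... | true | true = *-identityˡ (gz i w x)
      ... | true | false = *-zeroˡ (gz i w x)
      ... | false | true = refl
      ... | false | false = refl

    massAbove-V≡0 : ∀ i g k → InV i k g → ∀ z → ∣ z ∣ < k → massAbove i g z ≡ 0ℚ
    massAbove-V≡0 i g (suc k') (_ , o) z zk = trans (sumOver-cong (allPts n) (λ x → cong (λ v → if ∣ x ∣ ≡ᵇ i then g x * v else 0ℚ) (sym (gz≡above i z x))))
      (o (gz i z) (gz∈U i z k' (ℕP.≤-pred zk)))

    massAbove-minus : ∀ i F G z → massAbove i (λ x → F x - G x) z ≡ massAbove i F z - massAbove i G z
    massAbove-minus i F G z = trans (sumOver-cong (allPts n) pt) (sumOver-minus (allPts n) _ _)
      where
      pt : ∀ x → (if ∣ x ∣ ≡ᵇ i then (F x - G x) * above z x else 0ℚ) ≡ (if ∣ x ∣ ≡ᵇ i then F x * above z x else 0ℚ) - (if ∣ x ∣ ≡ᵇ i then G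
          x * above z x else 0ℚ)
      pt x with ∣ x ∣ ≡ᵇ i
      ... | true = solve 3 (λ f g h → (f :- g) :* h := f :* h :- g :* h) refl (F x) (G x) (above z x)
      ... | false = sym (+-inverseʳ 0ℚ)

    sumFns : List (Subset n × Fn n) → Fn n
    sumFns l x = sumℚ (map (λ p → proj₂ p x) l)

    massAbove-* : ∀ i c F z → massAbove i (λ x → c * F x) z ≡ c * massAbove i F z
    massAbove-* i c F z = trans (sumOver-cong (allPts n) pt) (sumOver-* (allPts n) c _)
      where
      pt : ∀ x → (if ∣ x ∣ ≡ᵇ i then (c * F x) * above z x else 0ℚ) ≡ c * (if ∣ x ∣ ≡ᵇ i then F x * above z x else 0ℚ)
      pt x with ∣ x ∣ ≡ᵇ i
      ... | true = *-assoc c (F x) (above z x)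
      ... | false = sym (*-zeroʳ c)

    module _ (y : Subset n) (i : ℕ) (d : Fn n)
      (zon : ∀ x x' → ∣ x ∣ ≡ i → ∣ x' ∣ ≡ i → inter x y ≡ inter x' y → d x ≡ d x')
      (top : ∀ x → ∣ x ∣ ≡ i → inter x y ≡ ∣ y ∣ → d x ≡ 0ℚ)
      (orth : ∀ z → subsetᵇ z y ≡ true → ∣ z ∣ < ∣ y ∣ → massAbove i d z ≡ 0ℚ) where

      -- Induction on k ≥ ∣ y ∣ - ∣ x ∩ y ∣: in ⟨d, g_{x∩y}⟩ the points with a larger intersection vanish
      -- by induction and the others share the value d x.
      zonal-vanishing-depth : ∀ k x → ∣ x ∣ ≡ i → ∣ y ∣ ∸ inter x y ≤ k → d x ≡ 0ℚ
      zonal-vanishing-depth zero x xi h = top x xi (ℕP.≤-antisym (inter≤∣∣ʳ x y) (ℕP.m∸n≡0⇒m≤n (ℕP.n≤0⇒n≡0 h)))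
      zonal-vanishing-depth (suc k) x xi h with ∣ y ∣ ∸ inter x y ℕP.≤? k
      ... | yes h' = zonal-vanishing-depth k x xi h'
      ... | no h' = ℕ→ℚ-suc*x≡0⇒x≡0 m (d x) (trans (*-comm (ℕ→ℚ (suc m)) (d x))
              (trans (cong (d x *_) (sym em)) (trans (sym (sumOver-* (allPts n) (d x) (λ x' → if cond x' then 1ℚ else 0ℚ)))
                (trans (sumOver-cong (allPts n) (λ x' → sym (if-* (cond x') (d x) 1ℚ) ∙ cong (λ v → if cond x' then v else 0ℚ) (*-identityʳ (d x))))
                  (trans (sym (sumOver-cong (allPts n) pt)) (orth z (∩-subsetᵇʳ x y) zt))))))
        where
        _∙_ = trans
        p = inter x y
        z = x ∩ y
        eq : ∣ y ∣ ∸ p ≡ suc k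
        eq = ℕP.≤-antisym h (ℕP.≰⇒> h')
        p<t : p < ∣ y ∣
        p<t = ℕP.m∸n≢0⇒n<m (λ e → ℕP.0≢1+n (trans (sym e) eq))
        zt : ∣ z ∣ < ∣ y ∣
        zt = subst (_< ∣ y ∣) (sym (∣∩∣≡inter x y)) p<t
        cond : Subset n → Bool
        cond x' = (∣ x' ∣ ≡ᵇ i) ∧ (subsetᵇ z x' ∧ (inter x' y ≡ᵇ p))
        condx : cond x ≡ true
        condx rewrite ≡⇒≡ᵇ-true _ _ xi | ∩-subsetᵇˡ x y | ≡⇒≡ᵇ-true p p refl = refl
        cnt = count-pos cond x condx
        m = proj₁ cnt
        em : sumPts n (λ x' → if cond x' then 1ℚ else 0ℚ) ≡ ℕ→ℚ (suc m)
        em = proj₂ cnt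
        pt : ∀ x' → (if ∣ x' ∣ ≡ᵇ i then d x' * above z x' else 0ℚ) ≡ (if cond x' then d x else 0ℚ)
        pt x' with ∣ x' ∣ ℕP.≟ i
        ... | no ne rewrite ≢⇒≡ᵇ-false _ _ ne = refl
        ... | yes e rewrite ≡⇒≡ᵇ-true _ _ e with subsetᵇ z x' in es
        ...   | false = *-zeroʳ (d x')
        ...   | true with inter x' y ℕP.≟ p
        ...     | yes e2 rewrite ≡⇒≡ᵇ-true _ _ e2 = trans (*-identityʳ (d x')) (zon x' x e xi e2)
        ...     | no ne2 rewrite ≢⇒≡ᵇ-false _ _ ne2 = trans (*-identityʳ (d x')) (zonal-vanishing-depth k x' e le)
          where
          pp' : p < inter x' y
          pp' = ℕP.≤∧≢⇒< (subsetᵇ-∩⇒inter-≤ x y x' es) (λ e3 → ne2 (sym e3))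
          le : ∣ y ∣ ∸ inter x' y ≤ k
          le = ℕP.≤-pred (subst (∣ y ∣ ∸ inter x' y <_) eq (ℕP.∸-monoʳ-< pp' (inter≤∣∣ʳ x' y)))

      zonal-vanishing : ∀ x → ∣ x ∣ ≡ i → d x ≡ 0ℚ
      zonal-vanishing x xi = zonal-vanishing-depth (∣ y ∣ ∸ inter x y) x xi ℕP.≤-refl

  module _ {n : ℕ} (r : ℕ) where

    ⟨,⟩B-+ : ∀ (F a b : Fn n) → ⟨_,_⟩B r F (λ x → a x + b x) ≡ ⟨_,_⟩B r F a + ⟨_,_⟩B r F b
    ⟨,⟩B-+ F a b = trans (sumOver-cong (allPts n) pt) (sumOver-+ (allPts n) _ _)
      where
      pt : ∀ x → (if ∣ x ∣ ≤ᵇ r then F x * (a x + b x) else 0ℚ) ≡ (if ∣ x ∣ ≤ᵇ r then F x * a x else 0ℚ) + (if ∣ x ∣ ≤ᵇ r then F x * b x else 0ℚ)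
      pt x with ∣ x ∣ ≤ᵇ r
      ... | true = *-distribˡ-+ (F x) (a x) (b x)
      ... | false = sym (+-identityˡ 0ℚ)

    lincomb-≡0 : ∀ (gs : List (Fn n)) (cs : Vec ℚ (length gs)) x → (∀ j → List.lookup gs j x ≡ 0ℚ) → lincomb r gs cs x ≡ 0ℚ
    lincomb-≡0 [] [] x h = refl
    lincomb-≡0 (g ∷ gs) (c ∷ cs) x h = trans (cong₂ (λ u v → c * u + v) (h Fin.zero) (lincomb-≡0 gs cs x (λ j → h (Fin.suc j)))) (trans
        (cong (_+ 0ℚ) (*-zeroʳ c)) (+-identityʳ 0ℚ))

    lincomb-single : ∀ (gs : List (Fn n)) (cs : Vec ℚ (length gs)) (k : Fin (length gs)) x → (∀ j → j ≢ k → List.lookup gs j x ≡ 0ℚ) →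
      lincomb r gs cs x ≡ lookup cs k * List.lookup gs k x
    lincomb-single (g ∷ gs) (c ∷ cs) Fin.zero x h = trans (cong (λ k → c * g x + k) (lincomb-≡0 gs cs x (λ j → h (Fin.suc j) (λ ())))) (+-identityʳ (c * g x))
    lincomb-single (g ∷ gs) (c ∷ cs) (Fin.suc k) x h = trans (cong₂ (λ u v → c * u + v) (h Fin.zero (λ ()))
        (lincomb-single gs cs k x (λ j ne → h (Fin.suc j) (λ e → ne (FinP.suc-injective e)))))
      (trans (cong (_+ (lookup cs k * List.lookup gs k x)) (*-zeroʳ c)) (+-identityˡ _))

  -- The functions f_{y,i}

  module Zonal (n r : ℕ) (2r≤n : 2 ℕ.* r ≤ n) (y : Subset n) (y∈B : ∣ y ∣ ≤ r) where

    t : ℕ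
    t = ∣ y ∣

    fy : ℕ → Fn n
    fy i x = profile n t i (inter x y) (diff x y)

    r+r≤n : r ℕ.+ r ≤ n
    r+r≤n = subst (_≤ n) (cong (r ℕ.+_) (ℕP.+-identityʳ r)) 2r≤n

    fy-off : ∀ i x → ∣ x ∣ ≢ i → fy i x ≡ 0ℚ
    fy-off i x ne = profile-off n t i (inter x y) (diff x y) (λ e → ne (trans (∣x∣≡inter+diff x y) e))

    fy-on : ∀ i x → ∣ x ∣ ≡ i → fy i x ≡ ψ (i ∸ t) (n ∸ i) (t ∸ inter x y)
    fy-on i x e = profile-on n t i (inter x y) (diff x y) (trans (sym (∣x∣≡inter+diff x y)) e)

    adjB≡adjCube : ∀ i → i ≤ r → ∀ w → adjB r (fy i) w ≡ adjCube (fy i) w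
    adjB≡adjCube i ir w = sumOver-cong (allPts n) pt
      where
      pt : ∀ x → (if ∣ x ∣ ≤ᵇ r then (if dist w x ≡ᵇ 1 then fy i x else 0ℚ) else 0ℚ) ≡ (if dist w x ≡ᵇ 1 then fy i x else 0ℚ)
      pt x with ∣ x ∣ ≤ᵇ r in e
      ... | true = refl
      ... | false with dist w x ≡ᵇ 1
      ...   | true = sym (fy-off i x (λ e' → ≤ᵇ-false⇒≰ _ _ e (subst (_≤ r) (sym e') ir)))
      ...   | false = refl

    adjCube-fy : ∀ i → t ≤ i → i ≤ r → ∀ w → ∣ w ∣ ≤ r →
      adjCube (fy i) w ≡ β n i * prevProfile n t i (inter w y) (diff w y) + γ n t i * nextProfile n r t i (inter w y) (diff w y)
    adjCube-fy i ti ir w wr = trans (sumPts-dist≡1 w (fy i)) (trans (neighbourSum-profile w y (profile n t i))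
      (neighbourCount-profile n r t i (inter w y) (diff w y) (diff y w) (outside w y) (∣y∣≡inter+diff w y) (n≡inter+diff+diff+outside w y) ti ir
        (subst (_≤ r) (∣x∣≡inter+diff w y) wr) r+r≤n))

    prevF-fy : ∀ i x → prevF fy t i x ≡ prevProfile n t i (inter x y) (diff x y)
    prevF-fy i x with t <ᵇ i
    ... | true = refl
    ... | false = refl

    nextF-fy : ∀ i x → nextF fy r i x ≡ nextProfile n r t i (inter x y) (diff x y)
    nextF-fy i x with i <ᵇ r
    ... | true = refl
    ... | false = refl

    adjB-fy : ∀ i → t ≤ i → i ≤ r → _≈B_ r (adjB r (fy i)) ((β n i • prevF fy t i) ⊕ (γ n t i • nextF fy r i))
    adjB-fy i ti ir x xr = trans (adjB≡adjCube i ir x) (trans (adjCube-fy i ti ir x xr)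
      (sym (cong₂ (λ u v → β n i * u + γ n t i * v) (prevF-fy i x) (nextF-fy i x))))

    fy-zonal : ∀ i x x' → ∣ x ∣ ≡ ∣ x' ∣ → dist x y ≡ dist x' y → fy i x ≡ fy i x'
    fy-zonal i x x' e1 e2 = cong₂ (profile n t i) ei (≡inter⇒≡diff y x x' e1 ei)
      where ei = ≡dist⇒≡inter x x' y e1 e2

    massAbove-fy≡0 : ∀ i → t ≤ i → i ≤ r → ∀ z → ∣ z ∣ < t → massAbove i (fy i) z ≡ 0ℚ
    massAbove-fy≡0 zero ti ir z zt = ⊥-elim (ℕP.<-irrefl refl (ℕP.<-≤-trans zt (ℕP.≤-trans ti z≤n)))
    massAbove-fy≡0 (suc j) ti ir z zt = ℕ→ℚ-suc*x≡0⇒x≡0 (j ∸ ∣ z ∣) (massAbove (suc j) (fy (suc j)) z) (trans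
        (cong (λ k → ℕ→ℚ k * massAbove (suc j) (fy (suc j)) z) (sym (ℕP.+-∸-assoc 1 zj)))
         (trans (sym (massAbove-adjCube j (fy (suc j)) z (fy-off (suc j)))) (lhs0 (t ℕP.<? suc j))))
      where
      zj : ∣ z ∣ ≤ j
      zj = ℕP.≤-pred (ℕP.<-≤-trans zt ti)
      jr : j ≤ r
      jr = ℕP.≤-trans (ℕP.n≤1+n j) ir
      LHS = sumPts n (λ w → if ∣ w ∣ ≡ᵇ j then adjCube (fy (suc j)) w * above z w else 0ℚ)
      nv : ∀ w → ∣ w ∣ ≡ j → nextProfile n r t (suc j) (inter w y) (diff w y) ≡ 0ℚ
      nv w e = nextProfile-off n r t (suc j) (inter w y) (diff w y) (λ e' → 2+n≢n j (trans (sym e') (trans (sym (∣x∣≡inter+diff w y)) e)))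
      lhs0 : Dec (t < suc j) → LHS ≡ 0ℚ
      lhs0 (yes t<sj) = trans (sumOver-cong (allPts n) pt) (trans (sumOver-* (allPts n) (β n (suc j)) (λ w → if ∣ w ∣ ≡ᵇ j then fy j w * above z w else 0ℚ))
               (trans (cong (β n (suc j) *_) (massAbove-fy≡0 j (ℕP.≤-pred t<sj) jr z zt)) (*-zeroʳ (β n (suc j)))))
        where
        pt : ∀ w → (if ∣ w ∣ ≡ᵇ j then adjCube (fy (suc j)) w * above z w else 0ℚ) ≡ β n (suc j) * (if ∣ w ∣ ≡ᵇ j then fy j w * above z w else 0ℚ)
        pt w with ∣ w ∣ ℕP.≟ j
        ... | no ne rewrite ≢⇒≡ᵇ-false _ _ ne = sym (*-zeroʳ (β n (suc j)))
        ... | yes e rewrite ≡⇒≡ᵇ-true _ _ e =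
              trans (cong (_* above z w) (trans (adjCube-fy (suc j) ti ir w (subst (_≤ r) (sym e) jr))
                      (cong₂ (λ u v → β n (suc j) * u + γ n t (suc j) * v) (prevProfile-on n t (suc j) (inter w y) (diff w y) t<sj) (nv w e))))
                (solve 4 (λ b f g c → (b :* f :+ c :* con 0ℚ) :* g := b :* (f :* g)) refl (β n (suc j)) (fy j w) (above z w) (γ n t (suc j)))
      lhs0 (no ¬t<sj) = sumOver-≡0 (allPts n) (λ w → if ∣ w ∣ ≡ᵇ j then adjCube (fy (suc j)) w * above z w else 0ℚ) pt
        where
        pt : ∀ w → (if ∣ w ∣ ≡ᵇ j then adjCube (fy (suc j)) w * above z w else 0ℚ) ≡ 0ℚ
        pt w with ∣ w ∣ ℕP.≟ j
        ... | no ne rewrite ≢⇒≡ᵇ-false _ _ ne = refl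
        ... | yes e rewrite ≡⇒≡ᵇ-true _ _ e =
              trans (cong (_* above z w) (trans (adjCube-fy (suc j) ti ir w (subst (_≤ r) (sym e) jr))
                      (cong₂ (λ u v → β n (suc j) * u + γ n t (suc j) * v) (prevProfile-bottom n t (suc j) (inter w y) (diff w y) ¬t<sj) (nv w e))))
                (solve 3 (λ b g c → (b :* con 0ℚ :+ c :* con 0ℚ) :* g := con 0ℚ) refl (β n (suc j)) (above z w) (γ n t (suc j)))

    fyOnInter : ℕ → Subset n → ℚ
    fyOnInter i s = ψ (i ∸ t) (n ∸ i) (t ∸ ∣ s ∣)

    fyCoeff : ℕ → Fn n
    fyCoeff i z = if subsetᵇ z y then möbius (fyOnInter i) z else 0ℚ

    fy∈U : ∀ i → InU i t (fy i)
    fy∈U i = fyCoeff i , λ x xi → trans (fy-on i x xi) (trans (cong (λ k → ψ (i ∸ t) (n ∸ i) (t ∸ k)) (sym (∣∩∣≡inter x y)))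
        (trans (sym (sum-möbius (fyOnInter i) (x ∩ y))) (sumOver-cong (allPts n) (pt x))))
      where
      pt : ∀ x z → (if subsetᵇ z (x ∩ y) then möbius (fyOnInter i) z else 0ℚ) ≡ (if ∣ z ∣ ≤ᵇ t then fyCoeff i z * gz i z x else 0ℚ)
      pt x z rewrite gz≡above i z x | subsetᵇ-∩ z x y with subsetᵇ z y in ezy
      ... | false rewrite ∧-zeroʳ (subsetᵇ z x) with ∣ z ∣ ≤ᵇ t
      ...   | true = sym (*-zeroˡ (above z x))
      ...   | false = refl
      pt x z | true rewrite ∧-identityʳ (subsetᵇ z x) | Equivalence.to T-≡ (ℕP.≤⇒≤ᵇ (subsetᵇ⇒∣∣-≤ z y ezy)) with subsetᵇ z x
      ...   | true = sym (*-identityʳ (möbius (fyOnInter i) z))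
      ...   | false = sym (*-zeroʳ (möbius (fyOnInter i) z))

    fy⊥U : ∀ i → t ≤ i → i ≤ r → ∀ k' → suc k' ≡ t → ∀ h' → InU i k' h' → ⟨_,_⟩Sl i (fy i) h' ≡ 0ℚ
    fy⊥U i ti ir k' ek h' (c , hc) = begin
        sumPts n (λ x → if ∣ x ∣ ≡ᵇ i then fy i x * h' x else 0ℚ)
          ≡⟨ sumOver-cong (allPts n) expand ⟩
        sumPts n (λ x → sumPts n (λ z → if ∣ x ∣ ≡ᵇ i then (if ∣ z ∣ ≤ᵇ k' then c z * (fy i x * above z x) else 0ℚ) else 0ℚ))
          ≡⟨ sumOver-comm (allPts n) (allPts n) _ ⟩
        sumPts n (λ z → sumPts n (λ x → if ∣ x ∣ ≡ᵇ i then (if ∣ z ∣ ≤ᵇ k' then c z * (fy i x * above z x) else 0ℚ) else 0ℚ))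
          ≡⟨ sumOver-≡0 (allPts n) _ each-vanishes ⟩
        0ℚ ∎
      where
      open ≡-Reasoning
      distribute : ∀ x z → fy i x * (if ∣ z ∣ ≤ᵇ k' then c z * gz i z x else 0ℚ) ≡ (if ∣ z ∣ ≤ᵇ k' then c z * (fy i x * above z x) else 0ℚ)
      distribute x z rewrite gz≡above i z x with ∣ z ∣ ≤ᵇ k'
      ... | true = solve 3 (λ f c g → f :* (c :* g) := c :* (f :* g)) refl (fy i x) (c z) (above z x)
      ... | false = *-zeroʳ (fy i x)
      expand : ∀ x → (if ∣ x ∣ ≡ᵇ i then fy i x * h' x else 0ℚ) ≡ sumPts n (λ z → if ∣ x ∣ ≡ᵇ i then
          (if ∣ z ∣ ≤ᵇ k' then c z * (fy i x * above z x) else 0ℚ) else 0ℚ)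
      expand x with ∣ x ∣ ℕP.≟ i
      ... | no ne rewrite ≢⇒≡ᵇ-false _ _ ne = sym (sumOver-0 (allPts n))
      ... | yes e rewrite ≡⇒≡ᵇ-true _ _ e = trans (cong (fy i x *_) (hc x e)) (trans (sym (sumOver-* (allPts n) (fy i x) _))
          (sumOver-cong (allPts n) (distribute x)))
      each-vanishes : ∀ z → sumPts n (λ x → if ∣ x ∣ ≡ᵇ i then (if ∣ z ∣ ≤ᵇ k' then c z * (fy i x * above z x) else 0ℚ) else 0ℚ) ≡ 0ℚ
      each-vanishes z with ∣ z ∣ ≤ᵇ k' in eb
      ... | false = sumOver-≡0 (allPts n) _ (λ x → if-0 (∣ x ∣ ≡ᵇ i))
      ... | true = trans (sumOver-cong (allPts n) (λ x → if-* (∣ x ∣ ≡ᵇ i) (c z) (fy i x * above z x)))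
            (trans (sumOver-* (allPts n) (c z) _) (trans (cong (c z *_) (massAbove-fy≡0 i ti ir z zt)) (*-zeroʳ (c z))))
        where
        zt : ∣ z ∣ < t
        zt = subst (∣ z ∣ <_) ek (s≤s (ℕP.≤ᵇ⇒≤ _ _ (subst T (sym eb) tt)))

    fy∈V : ∀ i → t ≤ i → i ≤ r → ∀ k → k ≡ t → InV i k (fy i)
    fy∈V i ti ir zero e = subst (λ k → InU i k (fy i)) (sym e) (fy∈U i)
    fy∈V i ti ir (suc k') e = subst (λ k → InU i k (fy i)) (sym e) (fy∈U i) , fy⊥U i ti ir k' e

    fy∈Vy : ∀ i → t ≤ i → i ≤ r → InVy i y (fy i)
    fy∈Vy i ti ir = fy∈V i ti ir t refl , λ x x' xi x'i e → fy-zonal i x x' (trans xi (sym x'i)) e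

    fy-above-y : ∀ i x → ∣ x ∣ ≡ i → subsetᵇ y x ≡ true → fy i x ≡ 1ℚ
    fy-above-y i x xi e = trans (fy-on i x xi) (cong (ψ (i ∸ t) (n ∸ i)) (trans (cong (t ∸_) (subsetᵇ⇒inter≡∣∣ x y e)) (ℕP.n∸n≡0 t)))

    fy-OneAbove : ∀ i → OneAbove i y (fy i)
    fy-OneAbove i x xi y⊆x = fy-above-y i x xi (⊆⇒subsetᵇ y x y⊆x)

    fy-unique : ∀ i → t ≤ i → i ≤ r → ∀ g → InVy i y g → OneAbove i y g → ∀ x → InSl i x → g x ≡ fy i x
    fy-unique i ti ir g (gv , gz) ga x xi = p-q≡0⇒p≡q (g x) (fy i x) (zonal-vanishing y i d zon top orth x xi)
      where
      d : Fn n
      d x = g x - fy i x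
      zon : ∀ x x' → ∣ x ∣ ≡ i → ∣ x' ∣ ≡ i → inter x y ≡ inter x' y → d x ≡ d x'
      zon x x' xi x'i e = cong₂ _-_ (gz x x' xi x'i (≡inter⇒≡dist y x x' (trans xi (sym x'i)) e))
                                    (fy-zonal i x x' (trans xi (sym x'i)) (≡inter⇒≡dist y x x' (trans xi (sym x'i)) e))
      top : ∀ x → ∣ x ∣ ≡ i → inter x y ≡ t → d x ≡ 0ℚ
      top x xi e = trans (cong₂ _-_ (ga x xi (subsetᵇ⇒⊆ y x sy)) (fy-above-y i x xi sy)) (+-inverseʳ 1ℚ)
        where sy = inter≡∣∣⇒subsetᵇ x y e
      orth : ∀ z → subsetᵇ z y ≡ true → ∣ z ∣ < t → massAbove i d z ≡ 0ℚ
      orth z _ zt = trans (massAbove-minus i g (fy i) z) (trans (cong₂ _-_ (massAbove-V≡0 i g t gv z zt) (massAbove-fy≡0 i ti ir z zt)) (+-inverseʳ 0ℚ))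

    module Orthogonality (i : ℕ) (ti : t ≤ i) (ir : i ≤ r) (z : Subset n) (zt : ∣ z ∣ < t) (h : Fn n) (hS : InS r z h) where
      fibre : Subset n → Subset n → Bool
      fibre s x' = (∣ x' ∣ ≡ᵇ i) ∧ (dist (x' ∩ z) s ≡ᵇ 0)

      fibreSize : Subset n → ℕ
      fibreSize s = proj₁ (count-ℕ (fibre s))

      -- h is constant on each fibre {x ∈ S(n,i) : x ∩ z = s}; fibreMean is that constant (and 0 on
      -- empty fibres, where frac 1 0 = 0).
      fibreMean : Subset n → ℚ
      fibreMean s = sumPts n (λ x' → if fibre s x' then h x' else 0ℚ) * frac 1 (fibreSize s)

      fibreMean-on : ∀ x → ∣ x ∣ ≡ i → fibreMean (x ∩ z) ≡ h x
      fibreMean-on x xi = begin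
          sumPts n (λ x' → if fibre s x' then h x' else 0ℚ) * frac 1 (fibreSize s)
            ≡⟨ cong (_* frac 1 (fibreSize s)) (trans (sumOver-cong (allPts n) pt)
                (trans (sumOver-* (allPts n) (h x) _) (cong (h x *_) (proj₂ (count-ℕ (fibre s)))))) ⟩
          h x * ℕ→ℚ (fibreSize s) * frac 1 (fibreSize s) ≡⟨ *-assoc (h x) _ _ ⟩
          h x * (ℕ→ℚ (fibreSize s) * frac 1 (fibreSize s)) ≡⟨ cong (h x *_) (ℕ→ℚ-*-frac1 (fibreSize s) pos) ⟩
          h x * 1ℚ ≡⟨ *-identityʳ (h x) ⟩
          h x ∎
        where
        open ≡-Reasoning
        s = x ∩ z
        cx : fibre s x ≡ true
        cx rewrite ≡⇒≡ᵇ-true _ _ xi | dist-refl s = refl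
        pos : 0 < fibreSize s
        pos with count-pos (fibre s) x cx
        ... | k , e = subst (0 <_) (ℕ→ℚ-injective (suc k) (fibreSize s) (trans (sym e) (proj₂ (count-ℕ (fibre s))))) (s≤s z≤n)
        ir' : ∣ x ∣ ≤ r
        ir' = subst (_≤ r) (sym xi) ir
        pt : ∀ x' → (if fibre s x' then h x' else 0ℚ) ≡ h x * (if fibre s x' then 1ℚ else 0ℚ)
        pt x' with ∣ x' ∣ ℕP.≟ i
        ... | no ne rewrite ≢⇒≡ᵇ-false _ _ ne = sym (*-zeroʳ (h x))
        ... | yes e rewrite ≡⇒≡ᵇ-true _ _ e with dist (x' ∩ z) s ℕP.≟ 0
        ...   | no ne rewrite ≢⇒≡ᵇ-false _ _ ne = sym (*-zeroʳ (h x))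
        ...   | yes e2 rewrite e2 = trans (hS x' x (subst (_≤ r) (sym e) ir) ir' (trans e (sym xi))
                                       (≡inter⇒≡dist z x' x (trans e (sym xi)) ie)) (sym (*-identityʳ (h x)))
          where
          ie : inter x' z ≡ inter x z
          ie = trans (sym (∣∩∣≡inter x' z)) (trans (cong ∣_∣ (dist≡0⇒≡ (x' ∩ z) s e2)) (∣∩∣≡inter x z))

      fy⊥S : ⟨_,_⟩B r (fy i) h ≡ 0ℚ
      fy⊥S = begin
          sumPts n (λ x → if ∣ x ∣ ≤ᵇ r then fy i x * h x else 0ℚ)
            ≡⟨ sumOver-cong (allPts n) expand ⟩
          sumPts n (λ x → sumPts n (λ v → if ∣ x ∣ ≡ᵇ i then (if subsetᵇ v z then möbius fibreMean v * (fy i x * above v x) else 0ℚ) else 0ℚ))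
            ≡⟨ sumOver-comm (allPts n) (allPts n) _ ⟩
          sumPts n (λ v → sumPts n (λ x → if ∣ x ∣ ≡ᵇ i then (if subsetᵇ v z then möbius fibreMean v * (fy i x * above v x) else 0ℚ) else 0ℚ))
            ≡⟨ sumOver-≡0 (allPts n) _ each-vanishes ⟩
          0ℚ ∎
        where
        open ≡-Reasoning
        restrict : ∀ x v → (if subsetᵇ v (x ∩ z) then möbius fibreMean v else 0ℚ) * fy i x ≡ (if subsetᵇ v z then möbius fibreMean v *
            (fy i x * above v x) else 0ℚ)
        restrict x v rewrite subsetᵇ-∩ v x z with subsetᵇ v z | subsetᵇ v x
        ... | true | true = solve 2 (λ m f → m :* f := m :* (f :* con 1ℚ)) refl (möbius fibreMean v) (fy i x)
        ... | true | false = trans (*-zeroˡ (fy i x)) (sym (trans (cong (möbius fibreMean v *_) (*-zeroʳ (fy i x))) (*-zeroʳ (möbius fibreMean v))))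
        ... | false | true = *-zeroˡ (fy i x)
        ... | false | false = *-zeroˡ (fy i x)
        expand : ∀ x → (if ∣ x ∣ ≤ᵇ r then fy i x * h x else 0ℚ) ≡ sumPts n (λ v → if ∣ x ∣ ≡ᵇ i then
            (if subsetᵇ v z then möbius fibreMean v * (fy i x * above v x) else 0ℚ) else 0ℚ)
        expand x with ∣ x ∣ ℕP.≟ i
        ... | no ne rewrite ≢⇒≡ᵇ-false _ _ ne | fy-off i x ne = trans (cong (λ w → if ∣ x ∣ ≤ᵇ r then w else 0ℚ) (*-zeroˡ (h x))) (trans
            (if-0 (∣ x ∣ ≤ᵇ r)) (sym (sumOver-0 (allPts n))))
        ... | yes e rewrite ≡⇒≡ᵇ-true _ _ e | Equivalence.to T-≡ (ℕP.≤⇒≤ᵇ (subst (_≤ r) (sym e) ir)) =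
              trans (*-comm (fy i x) (h x)) (trans (cong (_* fy i x) (trans (sym (fibreMean-on x e)) (sym (sum-möbius fibreMean (x ∩ z)))))
                (trans (sym (trans (sumOver-* (allPts n) (fy i x) _) (*-comm (fy i x) _)))
                    (sumOver-cong (allPts n) (λ v → trans (*-comm (fy i x) _) (restrict x v)))))
        each-vanishes : ∀ v → sumPts n (λ x → if ∣ x ∣ ≡ᵇ i then (if subsetᵇ v z then möbius fibreMean v * (fy i x * above v x) else 0ℚ) else 0ℚ) ≡ 0ℚ
        each-vanishes v with subsetᵇ v z in ev
        ... | false = sumOver-≡0 (allPts n) _ (λ x → if-0 (∣ x ∣ ≡ᵇ i))
        ... | true = trans (sumOver-cong (allPts n) (λ x → if-* (∣ x ∣ ≡ᵇ i) (möbius fibreMean v) (fy i x * above v x)))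
              (trans (sumOver-* (allPts n) (möbius fibreMean v) _) (trans
                  (cong (möbius fibreMean v *_) (massAbove-fy≡0 i ti ir v (ℕP.≤-<-trans (subsetᵇ⇒∣∣-≤ v z ev) zt))) (*-zeroʳ (möbius fibreMean v))))

    module _ (i : ℕ) (ti : t ≤ i) (ir : i ≤ r) where
      fy⊥span : ∀ l G (w : InSpanLower r y G) → proj₁ w ≡ l → ⟨_,_⟩B r (fy i) (sumFns l) ≡ 0ℚ
      fy⊥span [] G w e = sumOver-≡0 (allPts n) _ (λ x → trans (cong (λ v → if ∣ x ∣ ≤ᵇ r then v else 0ℚ) (*-zeroʳ (fy i x))) (if-0 (∣ x ∣ ≤ᵇ r)))
      fy⊥span ((z , h) ∷ l) G (.((z , h) ∷ l) , ((zB , zt , hS) , al) , eq) refl =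
        trans (⟨,⟩B-+ r (fy i) h (sumFns l)) (trans (cong₂ _+_ (Orthogonality.fy⊥S i ti ir z zt h hS)
            (fy⊥span l (sumFns l) (l , al , λ x _ → refl) refl)) (+-identityˡ 0ℚ))

      fy∈W : InW r y (fy i)
      fy∈W = (λ x x' _ _ e1 e2 → fy-zonal i x x' e1 e2) , λ g w →
        trans (sumOver-cong (allPts n) (pt g w)) (fy⊥span (proj₁ w) g w refl)
        where
        pt : ∀ g (w : InSpanLower r y g) x → (if ∣ x ∣ ≤ᵇ r then fy i x * g x else 0ℚ) ≡ (if ∣ x ∣ ≤ᵇ r then fy i x * sumFns (proj₁ w) x else 0ℚ)
        pt g (l , al , eq) x with ∣ x ∣ ≤ᵇ r in eb
        ... | true = cong (fy i x *_) (eq x (ℕP.≤ᵇ⇒≤ _ _ (subst T (sym eb) tt)))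
        ... | false = refl

    basisList : List (Fn n)
    basisList = famList fy t r

    r≤n : r ≤ n
    r≤n = ℕP.≤-trans (ℕP.m≤m+n r r) r+r≤n

    length-basisList : length basisList ≡ suc (r ∸ t)
    length-basisList = trans (length-map (λ j → fy (t ℕ.+ j)) (upTo (suc (r ∸ t)))) (length-upTo (suc (r ∸ t)))

    lookup-basisList : ∀ k → List.lookup basisList k ≡ fy (t ℕ.+ toℕ k)
    lookup-basisList k = lookup-map-applyUpTo (λ j → fy (t ℕ.+ j)) (λ j → j) (suc (r ∸ t)) k

    level-bound : ∀ (k : Fin (length basisList)) → t ℕ.+ toℕ k ≤ r
    level-bound k = ℕP.≤-trans (ℕP.+-monoʳ-≤ t (ℕP.≤-pred (subst (toℕ k <_) length-basisList (FinP.toℕ<n k)))) (ℕP.≤-reflexive (ℕP.m+[n∸m]≡n y∈B))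

    witness : (k : Fin (length basisList)) → ∃ λ x → subsetᵇ y x ≡ true × ∣ x ∣ ≡ t ℕ.+ toℕ k
    witness k = superset-of-size y (t ℕ.+ toℕ k) (ℕP.m≤m+n t _) (ℕP.≤-trans (level-bound k) r≤n)

    witnessAt : Fin (length basisList) → Subset n
    witnessAt k = proj₁ (witness k)

    basis-∈W : ∀ k → InW r y (List.lookup basisList k)
    basis-∈W k = subst (InW r y) (sym (lookup-basisList k)) (fy∈W (t ℕ.+ toℕ k) (ℕP.m≤m+n t _) (level-bound k))

    basisList-off : ∀ x (k : Fin (length basisList)) → ∣ x ∣ ≡ t ℕ.+ toℕ k → ∀ j → j ≢ k → List.lookup basisList j x ≡ 0ℚ
    basisList-off x k xi j ne = trans (cong (λ f → f x) (lookup-basisList j)) (fy-off (t ℕ.+ toℕ j) x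
        (λ e → ne (FinP.toℕ-injective (ℕP.+-cancelˡ-≡ t _ _ (trans (sym e) xi)))))

    basis-independent : ∀ (cs : Vec ℚ (length basisList)) → _≈B_ r (lincomb r basisList cs) (λ _ → 0ℚ) → ∀ k → lookup cs k ≡ 0ℚ
    basis-independent cs hz k = trans (sym (*-identityʳ (lookup cs k))) (trans (cong (lookup cs k *_) (sym one))
        (trans (sym (lincomb-single r basisList cs k x (basisList-off x k xi))) (hz x (subst (_≤ r) (sym xi) (level-bound k)))))
      where
      x = witnessAt k
      xi = proj₂ (proj₂ (witness k))
      one : List.lookup basisList k x ≡ 1ℚ
      one = trans (cong (λ f → f x) (lookup-basisList k)) (fy-above-y _ x xi (proj₁ (proj₂ (witness k))))

    massAbove-W≡0 : ∀ h → InW r y h → ∀ i → i ≤ r → ∀ z → ∣ z ∣ < t → massAbove i h z ≡ 0ℚ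
    massAbove-W≡0 h hW i ir z zt = trans (sym (sumOver-cong (allPts n) pt)) (proj₂ hW q lst)
      where
      q : Fn n
      q x = if ∣ x ∣ ≡ᵇ i then above z x else 0ℚ
      qS : InS r z q
      qS x x' _ _ e1 e2 = cong₂ (λ a b → if a then (if b then 1ℚ else 0ℚ) else 0ℚ) (cong (_≡ᵇ i) e1)
        (trans (subsetᵇ≡inter≡ᵇ∣∣ z x) (trans (cong (_≡ᵇ ∣ z ∣) (≡dist⇒≡inter x x' z e1 e2)) (sym (subsetᵇ≡inter≡ᵇ∣∣ z x'))))
      zB : ∣ z ∣ ≤ r
      zB = ℕP.≤-trans (ℕP.<⇒≤ zt) y∈B
      lst : InSpanLower r y q
      lst = (z , q) ∷ [] , ((zB , zt , qS) , tt) , λ x _ → sym (+-identityʳ (q x))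
      pt : ∀ x → (if ∣ x ∣ ≤ᵇ r then h x * q x else 0ℚ) ≡ (if ∣ x ∣ ≡ᵇ i then h x * above z x else 0ℚ)
      pt x with ∣ x ∣ ℕP.≟ i
      ... | yes e rewrite ≡⇒≡ᵇ-true _ _ e | Equivalence.to T-≡ (ℕP.≤⇒≤ᵇ (subst (_≤ r) (sym e) ir)) = refl
      ... | no ne rewrite ≢⇒≡ᵇ-false _ _ ne = trans (cong (λ v → if ∣ x ∣ ≤ᵇ r then v else 0ℚ) (*-zeroʳ (h x))) (if-0 (∣ x ∣ ≤ᵇ r))

    W-on-level : ∀ h → InW r y h → ∀ (k : Fin (length basisList)) x → ∣ x ∣ ≡ t ℕ.+ toℕ k → h x ≡ h (witnessAt k) * fy (t ℕ.+ toℕ k) x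
    W-on-level h hW k x xi = p-q≡0⇒p≡q (h x) (c * fy i' x) (zonal-vanishing y i' d zon top orth x xi)
      where
      i' = t ℕ.+ toℕ k
      c = h (witnessAt k)
      ir' = level-bound k
      d : Fn n
      d x = h x - c * fy i' x
      inB : ∀ x → ∣ x ∣ ≡ i' → ∣ x ∣ ≤ r
      inB x e = subst (_≤ r) (sym e) ir'
      zon : ∀ x x' → ∣ x ∣ ≡ i' → ∣ x' ∣ ≡ i' → inter x y ≡ inter x' y → d x ≡ d x'
      zon x x' xi x'i e = cong₂ (λ a b → a - c * b)
         (proj₁ hW x x' (inB x xi) (inB x' x'i) (trans xi (sym x'i)) (≡inter⇒≡dist y x x' (trans xi (sym x'i)) e))
         (fy-zonal i' x x' (trans xi (sym x'i)) (≡inter⇒≡dist y x x' (trans xi (sym x'i)) e))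
      top : ∀ x → ∣ x ∣ ≡ i' → inter x y ≡ t → d x ≡ 0ℚ
      top x xi e = trans (cong₂ (λ a b → a - c * b) hx (fy-above-y i' x xi (inter≡∣∣⇒subsetᵇ x y e))) (solve 1 (λ c → c :- c :* con 1ℚ := con 0ℚ) refl c)
        where
        pk = witness k
        hx : h x ≡ c
        hx = proj₁ hW x (witnessAt k) (inB x xi) (inB (witnessAt k) (proj₂ (proj₂ pk))) (trans xi (sym (proj₂ (proj₂ pk))))
               (≡inter⇒≡dist y x (witnessAt k) (trans xi (sym (proj₂ (proj₂ pk)))) (trans e (sym (subsetᵇ⇒inter≡∣∣ (witnessAt k) y (proj₁ (proj₂ pk))))))
      orth : ∀ z → subsetᵇ z y ≡ true → ∣ z ∣ < t → massAbove i' d z ≡ 0ℚ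
      orth z _ zt = trans (massAbove-minus i' h (λ x → c * fy i' x) z) (trans (cong₂ _-_ (massAbove-W≡0 h hW i' ir' z zt)
         (trans (massAbove-* i' c (fy i') z) (trans (cong (c *_) (massAbove-fy≡0 i' (ℕP.m≤m+n t _) ir' z zt)) (*-zeroʳ c)))) (+-inverseʳ 0ℚ))

    W-below-level : ∀ h → InW r y h → ∀ x → ∣ x ∣ ≤ r → ∣ x ∣ < t → h x ≡ 0ℚ
    W-below-level h hW x xr xt = zonal-vanishing y ∣ x ∣ h zon top orth x refl
      where
      zon : ∀ x1 x2 → ∣ x1 ∣ ≡ ∣ x ∣ → ∣ x2 ∣ ≡ ∣ x ∣ → inter x1 y ≡ inter x2 y → h x1 ≡ h x2
      zon x1 x2 e1 e2 e = proj₁ hW x1 x2 (subst (_≤ r) (sym e1) xr) (subst (_≤ r) (sym e2) xr) (trans e1 (sym e2))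
         (≡inter⇒≡dist y x1 x2 (trans e1 (sym e2)) e)
      top : ∀ x1 → ∣ x1 ∣ ≡ ∣ x ∣ → inter x1 y ≡ t → h x1 ≡ 0ℚ
      top x1 e1 e = ⊥-elim (ℕP.<-irrefl refl (ℕP.≤-<-trans (subst (_≤ ∣ x ∣) e (subst (inter x1 y ≤_) e1 (inter≤∣∣ˡ x1 y))) xt))
      orth : ∀ z → subsetᵇ z y ≡ true → ∣ z ∣ < t → massAbove ∣ x ∣ h z ≡ 0ℚ
      orth z _ zt = massAbove-W≡0 h hW ∣ x ∣ xr z zt

    basis-spans : ∀ h → InW r y h → ∃ λ (cs : Vec ℚ (length basisList)) → _≈B_ r h (lincomb r basisList cs)
    basis-spans h hW = cs , λ x xr → sp x xr (t ℕP.≤? ∣ x ∣)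
      where
      cs : Vec ℚ (length basisList)
      cs = tabulate (λ k → h (witnessAt k))
      sp : ∀ x → ∣ x ∣ ≤ r → Dec (t ≤ ∣ x ∣) → h x ≡ lincomb r basisList cs x
      sp x xr (yes t≤i) = trans (W-on-level h hW k x xi) (trans (cong₂ _*_ (sym (VecP.lookup∘tabulate (λ k → h (witnessAt k)) k))
          (sym (cong (λ f → f x) (lookup-basisList k))))
          (sym (lincomb-single r basisList cs k x (basisList-off x k xi))))
        where
        lt : ∣ x ∣ ∸ t < length basisList
        lt = subst (∣ x ∣ ∸ t <_) (sym length-basisList) (s≤s (ℕP.∸-monoˡ-≤ t xr))
        k = fromℕ< lt
        xi : ∣ x ∣ ≡ t ℕ.+ toℕ k
        xi = sym (trans (cong (t ℕ.+_) (FinP.toℕ-fromℕ< lt)) (ℕP.m+[n∸m]≡n t≤i))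
      sp x xr (no ¬t≤i) = trans (W-below-level h hW x xr (ℕP.≰⇒> ¬t≤i)) (sym (lincomb-≡0 r basisList cs x (λ j → trans (cong (λ f → f x) (lookup-basisList j))
          (fy-off _ x (λ e → ¬t≤i (subst (t ≤_) (sym e) (ℕP.m≤m+n t _)))))))

    basisList-isBasis : IsBasis r (InW r y) basisList
    basisList-isBasis = basis-∈W , basis-independent , basis-spans

    W-hasDim : HasDim r (InW r y) (r ∸ ∣ y ∣ ℕ.+ 1)
    W-hasDim = basisList , trans length-basisList (ℕP.+-comm 1 (r ∸ t)) , basisList-isBasis

open import Defs
open import Data.Nat using (ℕ; _≤_; _*_; _+_; _∸_)
open import Data.Fin.Subset using (Subset; ∣_∣)
open import Data.Rational using (0ℚ)
open import Data.Product using (Σ; _×_; _,_)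
open import Relation.Binary.PropositionalEquality using (_≡_)
open import Relation.Nullary using (¬_)

corollary2p4 : (n r : ℕ) → 2 * r ≤ n → (y : Subset n) → InB r y →
  HasDim r (InW r y) (r ∸ ∣ y ∣ + 1)
  × Σ (ℕ → Fn n) (λ f →
      (∀ i → ∣ y ∣ ≤ i → i ≤ r →
        (InVy i y (f i) × OneAbove i y (f i))
        × (∀ g → InVy i y g → OneAbove i y g → ∀ x → InSl i x → g x ≡ f i x)
        × (∀ x → InB r x → ¬ (∣ x ∣ ≡ i) → f i x ≡ 0ℚ)
        × _≈B_ r (adjB r (f i)) ((β n i • prevF f ∣ y ∣ i) ⊕ (γ n ∣ y ∣ i • nextF f r i)))
      × IsBasis r (InW r y) (famList f ∣ y ∣ r))
corollary2p4 n r 2r≤n y y∈B =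
  W-hasDim ,
  fy ,
  (λ i t≤i i≤r → (fy∈Vy i t≤i i≤r , fy-OneAbove i) , fy-unique i t≤i i≤r , (λ x _ → fy-off i x) , adjB-fy i t≤i i≤r) ,
  basisList-isBasis
  where open HammingBall.Zonal n r 2r≤n y y∈B
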